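{- Let $p$ and $q$ be distinct odd primes and let $(G,\boldsymbol{\gamma})$ be a $\mathbb{Z}/p\mathbb{Z}\times\mathbb{Z}/q\mathbb{Z}$-colored graph with $n$ vertices and $2n-1$ edges. Then $(G,\boldsymbol{\gamma})$ is cone-Laman if and only if its symmetric lift is Laman-sparse.
   Context: Let $\Gamma=\mathbb{Z}/p\mathbb{Z}\times\mathbb{Z}/q\mathbb{Z}$. A $\Gamma$-colored graph is a finite directed multigraph $G=(V,E)$ (self-loops and parallel edges allowed) with a color $\gamma_e\in\Gamma$ on each edge. For a cycle $C$, $\rho(C)\in\Gamma$ is the oriented sum of colors along $C$: add the colors of edges traversed forwards and subtract those traversed backwards. The $\rho$-rank of a subgraph is $0$ if all its cycles have $\rho(C)=0$, and $1$ otherwise. The colored graph is cone-Laman-sparse if every edge-induced subgraph with $n'$ vertices, $m'$ edges, $c'_0$ connected components of $\rho$-rank $0$ and $c'_1$ of $\rho$-rank $1$ satisfies $m'\le 2n'-3c'_0-c'_1$. It is cone-Laman if, moreover, equality holds for the whole graph. The symmetric lift is the undirected multigraph with vertices $\tilde i_\delta$ ($i\in V$, $\delta\in\Gamma$). For each directed edge $ij$ of color $\gamma_{ij}$ and each $\delta\in\Gamma$, it has an edge $\tilde i_\delta\tilde j_{\delta+\gamma_{ij}}$. An undirected multigraph is Laman-sparse if every subgraph with $n'$ vertices and $m'\ge1$ edges satisfies $m'\le 2n'-3$. -}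

module Defs where

open import Data.Nat using (ℕ; _+_; _*_; _≤_; NonZero)
open import Data.Nat.DivMod using (_mod_)
open import Data.Fin using (Fin; toℕ)
open import Data.Fin.Properties using () renaming (_≟_ to _≟ᶠ_)
open import Data.Integer using (ℤ; +_; -_) renaming (_+_ to _+ℤ_)
open import Data.Integer.Divisibility using () renaming (_∣_ to _∣ℤ_)
open import Data.Product using (_×_; _,_; proj₁; proj₂; ∃₂)
open import Data.Product.Properties using (≡-dec)
open import Data.List using (List; []; _∷_; _++_; map; length; concatMap; deduplicate; allFin; cartesianProduct)
open import Data.List.Membership.Propositional using (_∈_)
open import Data.List.Relation.Binary.Sublist.Propositional using (_⊆_)
open import Data.List.Relation.Unary.All using (All)
open import Data.List.Relation.Unary.Unique.Propositional using (Unique)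
open import Data.List.Relation.Unary.Any using (Any)
open import Relation.Binary.PropositionalEquality using (_≡_; _≢_)
open import Relation.Nullary using (¬_)

-- Γ = ℤ/pℤ × ℤ/qℤ, elements represented by Fin p × Fin q.

Γ : ℕ → ℕ → Set
Γ p q = Fin p × Fin q

_⊕[_,_]_ : ∀ {p q} → Γ p q → (p' q' : ℕ) → .{{_ : NonZero p'}} → .{{_ : NonZero q'}} → Γ p q → Γ p' q'
(a , b) ⊕[ p , q ] (c , d) = ((toℕ a + toℕ c) mod p) , ((toℕ b + toℕ d) mod q)

-- Γ-colored graphs: vertex set Fin n, a finite list of directed edges
-- (tail , head , color).  Parallel edges and self-loops are allowed.
-- The number of edges is the length of the list.

CEdge : ℕ → ℕ → ℕ → Set
CEdge n p q = Fin n × Fin n × Γ p q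

tl : ∀ {n p q} → CEdge n p q → Fin n
tl (i , j , γ) = i

hd : ∀ {n p q} → CEdge n p q → Fin n
hd (i , j , γ) = j

col : ∀ {n p q} → CEdge n p q → Γ p q
col (i , j , γ) = γ

-- Edge-induced subgraphs are sub-multisets S of the edge list E,
-- modelled as sublists S ⊆ E.

endpoints : ∀ {n p q} → List (CEdge n p q) → List (Fin n)
endpoints S = map tl S ++ map hd S

nVerts : ∀ {n p q} → List (CEdge n p q) → ℕ
nVerts S = length (deduplicate _≟ᶠ_ (endpoints S))

data Walk {n p q} (S : List (CEdge n p q)) : Fin n → Fin n → Set where
  stop : ∀ {v} → Walk S v v
  fwd  : ∀ {w} (e : CEdge n p q) → e ∈ S → Walk S (hd e) w → Walk S (tl e) w
  bwd  : ∀ {w} (e : CEdge n p q) → e ∈ S → Walk S (tl e) w → Walk S (hd e) w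

-- oriented sum of colours along a walk, computed in ℤ × ℤ
-- (its image in ℤ/p × ℤ/q is the ρ-value)
ρℤ : ∀ {n p q} {S : List (CEdge n p q)} {u v} → Walk S u v → ℤ × ℤ
ρℤ stop = (+ 0 , + 0)
ρℤ (fwd (i , j , (a , b)) _ w) = ((+ toℕ a) +ℤ proj₁ (ρℤ w) , (+ toℕ b) +ℤ proj₂ (ρℤ w))
ρℤ (bwd (i , j , (a , b)) _ w) = ((- (+ toℕ a)) +ℤ proj₁ (ρℤ w) , (- (+ toℕ b)) +ℤ proj₂ (ρℤ w))

ρZero : ∀ {n} (p q : ℕ) {S : List (CEdge n p q)} {u v} → Walk S u v → Set
ρZero p q w = ((+ p) ∣ℤ proj₁ (ρℤ w)) × ((+ q) ∣ℤ proj₂ (ρℤ w))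

-- the connected component of S containing v has ρ-rank 0:
-- every closed walk (cycle) in that component has ρ = 0
RankZero : ∀ {n} (p q : ℕ) → List (CEdge n p q) → Fin n → Set
RankZero p q S v = ∀ u → Walk S v u → (c : Walk S u u) → ρZero p q c

-- L0 , L1 list representatives of the connected components of the
-- edge-induced subgraph S: one vertex per component, those in L0 having
-- ρ-rank 0 and those in L1 having ρ-rank 1.  Hence c'_0 = length L0 and
-- c'_1 = length L1.
Components : ∀ {n} (p q : ℕ) → List (CEdge n p q) → List (Fin n) → List (Fin n) → Set
Components {n} p q S L0 L1 =
    All (_∈ endpoints S) (L0 ++ L1)
  × Unique (L0 ++ L1)
  × (∀ r r' → r ∈ L0 ++ L1 → r' ∈ L0 ++ L1 → r ≢ r' → ¬ Walk S r r')
  × (∀ v → v ∈ endpoints S → Any (Walk S v) (L0 ++ L1))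
  × All (RankZero p q S) L0
  × All (λ r → ¬ RankZero p q S r) L1

ConeLamanSparse : ∀ {n} (p q : ℕ) → List (CEdge n p q) → Set
ConeLamanSparse p q E =
  ∀ S → S ⊆ E → ∀ L0 L1 → Components p q S L0 L1 →
    length S + 3 * length L0 + length L1 ≤ 2 * nVerts S

ConeLaman : ∀ {n} (p q : ℕ) → List (CEdge n p q) → Set
ConeLaman p q E =
  ConeLamanSparse p q E ×
  (∃₂ λ L0 L1 → Components p q E L0 L1 ×
    length E + 3 * length L0 + length L1 ≡ 2 * nVerts E)

-- Undirected multigraphs given by a list of edges (unordered pairs,
-- recorded as pairs of endpoints) over a vertex type with decidable equality.

LamanSparse : {V : Set} → (∀ (x y : V) → Relation.Nullary.Dec (x ≡ y)) → List (V × V) → Set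
LamanSparse {V} _≟_ E =
  ∀ S → S ⊆ E → 1 ≤ length S →
    length S + 3 ≤ 2 * length (deduplicate _≟_ (map proj₁ S ++ map proj₂ S))

-- vertices of the lift: ĩ_δ ↦ (i , δ)
LiftV : ℕ → ℕ → ℕ → Set
LiftV n p q = Fin n × Γ p q

_≟L_ : ∀ {n p q} (x y : LiftV n p q) → Relation.Nullary.Dec (x ≡ y)
_≟L_ = ≡-dec _≟ᶠ_ (≡-dec _≟ᶠ_ _≟ᶠ_)

allΓ : (p q : ℕ) → List (Γ p q)
allΓ p q = cartesianProduct (allFin p) (allFin q)

lift : ∀ {n} (p q : ℕ) .{{_ : NonZero p}} .{{_ : NonZero q}} →
       List (CEdge n p q) → List (LiftV n p q × LiftV n p q)
lift p q E =
  concatMap (λ e → map (λ δ → ((tl e , δ) , (hd e , δ ⊕[ p , q ] col e))) (allΓ p q)) E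

{-# OPTIONS --safe #-}
-- Write N = p q.
--
-- (⇐) Split a subgraph S ⊆ E into its connected components. The lift of a component C has
-- N |C| edges on at most N n(C) vertices, so Laman-sparsity of the lift gives |C| + 1 ≤ 2 n(C).
-- If C has ρ-rank 0, ρ is a coboundary on C: there is a potential π with π(j) = π(i) + γ_ij on
-- every edge ij, and the edges ĩ_π(i) j̃_π(j) form a copy of C inside the lift, which gives
-- |C| + 3 ≤ 2 n(C). Summing over components yields cone-Laman-sparsity; with 2n − 1 edges,
-- sparsity leaves room only for a single component, of ρ-rank 1, which forces equality.
--
-- (⇒) For a nonempty subgraph X of the lift let f(v) be the number of lifts of v that X
-- touches, and let layer t consist of the edges of G with at least t copies in X. Then
-- |X| = Σ_t |layer t|, the vertices of X number Σ_t #{v | f(v) ≥ t}, and the endpoints of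
-- layer t all have f ≥ t, so cone-Laman-sparsity of the layers gives |X| ≤ 2 |V(X)|. The
-- missing 3 comes from the first three layers: if some f(v) ≥ 3, each of them contains a
-- component. Otherwise the top layer t = max f ≤ 2 has only components of ρ-rank 0, each
-- worth 3: walking around a closed walk c moves each lift point by ρ(c) inside a fibre with
-- at most two points, so ρ(c) or 2ρ(c) vanishes, and 2 is invertible in Γ as p, q are odd.

module Submission where

open import Defs
open import Data.Empty using (⊥; ⊥-elim)
open import Data.Fin using (Fin; toℕ; fromℕ<)
import Data.Fin.Properties as Fin
open import Data.Integer using (ℤ; +_; -_; ∣_∣) renaming (_+_ to _+ℤ_; _-_ to _-ℤ_; _*_ to _*ℤ_)
import Data.Integer.Divisibility as Unsigned
open import Data.Integer.Divisibility.Signed using (_∣_; divides; ∣m∣n⇒∣m+n; ∣m⇒∣-m; ∣⇒∣ᵤ; ∣ᵤ⇒∣)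
open import Data.Integer.DivMod using (_/ℕ_; n%ℕd<d; a≡a%ℕn+[a/ℕn]*n)
import Data.Integer.Properties as ℤ
open import Data.Integer.Tactic.RingSolver using (solve-∀)
open import Data.List using (List; []; _∷_; _++_; map; length; filter; deduplicate; allFin; cartesianProduct)
import Data.List.Properties as List
open import Data.List.Membership.Propositional using (_∈_; find; lose)
open import Data.List.Membership.Propositional.Properties
import Data.List.Membership.DecPropositional as DecMembership
open import Data.List.Relation.Binary.Sublist.Propositional using (_⊆_; []; _∷_; _∷ʳ_; ⊆-refl; ⊆-trans; lookup)
open import Data.List.Relation.Binary.Sublist.Propositional.Properties using (++⁺; ++⁺ˡ; filter-⊆; length-mono-≤)
open import Data.List.Relation.Binary.Subset.Propositional using () renaming (_⊆_ to _⊆ˢ_)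
open import Data.List.Relation.Unary.All using (All; []; _∷_)
import Data.List.Relation.Unary.All as All
open import Data.List.Relation.Unary.Any using (Any; here; there)
open import Data.List.Relation.Unary.Unique.Propositional using (Unique; []; _∷_)
import Data.List.Relation.Unary.Unique.Propositional.Properties as Unique
import Data.List.Relation.Unary.Unique.DecPropositional.Properties as UniqueDec
open import Data.Nat using (ℕ; zero; suc; _+_; _*_; _∸_; _≤_; _<_; _≤?_; z≤n; s≤s; NonZero)
open import Data.Nat.Base using (nonTrivial⇒n>1; >-nonZero⁻¹)
import Data.Nat.Divisibility as ℕ
open import Data.Nat.DivMod using (_mod_)
open import Data.Nat.Primality using (Prime; euclidsLemma; prime⇒nonZero; prime⇒nonTrivial)
open import Data.Nat.Properties
import Data.Nat.Tactic.RingSolver as ℕ-Solver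
open import Data.Product using (Σ; ∃; ∃₂; _×_; _,_; proj₁; proj₂)
open import Data.Product.Properties using (≡-dec)
open import Data.Sum using (_⊎_; inj₁; inj₂)
open import Data.Unit using (tt)
open import Effect.Monad using (RawMonad)
open import Function.Bundles using (_⇔_; mk⇔)
open import Level using (0ℓ)
open import Relation.Binary.Bundles using (Setoid)
open import Relation.Binary.Definitions using (DecidableEquality)
open import Relation.Binary.PropositionalEquality
  using (_≡_; _≢_; refl; sym; trans; cong; cong₂; subst; subst₂; module ≡-Reasoning)
open import Relation.Nullary using (¬_; Dec; yes; no; ¬?; map′; _×-dec_; _⊎-dec_; _→-dec_)
open import Relation.Nullary.Decidable using (decidable-stable; ¬¬-excluded-middle)
open import Relation.Nullary.Negation using (¬¬-Monad)
open import Relation.Unary using (Decidable)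

open RawMonad (¬¬-Monad {0ℓ}) using (pure; _>>=_)

-- Counting in lists

module _ {A : Set} where

  Unique⇒length≤ : ∀ {xs ys : List A} → Unique xs → xs ⊆ˢ ys → length xs ≤ length ys
  Unique⇒length≤ {[]} _ _ = z≤n
  Unique⇒length≤ {x ∷ xs} {ys} (x∉xs ∷ u) xs⊆ys =
    subst (suc (length xs) ≤_) (length-remove ys x∈ys)
      (s≤s (Unique⇒length≤ u (λ z∈xs → ∈-remove ys x∈ys (xs⊆ys (there z∈xs)) (≢x z∈xs))))
    where
    x∈ys : x ∈ ys
    x∈ys = xs⊆ys (here refl)

    remove : ∀ {y} zs → y ∈ zs → List A
    remove (z ∷ zs) (here _) = zs
    remove (z ∷ zs) (there m) = z ∷ remove zs m

    length-remove : ∀ {y} zs (m : y ∈ zs) → suc (length (remove zs m)) ≡ length zs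
    length-remove (z ∷ zs) (here _) = refl
    length-remove (z ∷ zs) (there m) = cong suc (length-remove zs m)

    ∈-remove : ∀ {y z} zs (m : y ∈ zs) → z ∈ zs → z ≢ y → z ∈ remove zs m
    ∈-remove (_ ∷ _) (here refl) (here refl) z≢y = ⊥-elim (z≢y refl)
    ∈-remove (_ ∷ _) (here _) (there k) _ = k
    ∈-remove (_ ∷ _) (there m) (here refl) _ = here refl
    ∈-remove (_ ∷ zs) (there m) (there k) z≢y = there (∈-remove zs m k z≢y)

    ≢x : ∀ {z} → z ∈ xs → z ≢ x
    ≢x z∈xs z≡x = All.lookup x∉xs z∈xs (sym z≡x)

length-pos⇒∈ : ∀ {A : Set} {xs : List A} → 1 ≤ length xs → Σ A (_∈ xs)
length-pos⇒∈ {xs = x ∷ _} _ = x , here refl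

module _ {A : Set} where

  ⊆-++⁻ : ∀ {xs : List A} ys {zs} → xs ⊆ ys ++ zs →
    Σ (List A) λ xs₁ → Σ (List A) λ xs₂ → xs ≡ xs₁ ++ xs₂ × xs₁ ⊆ ys × xs₂ ⊆ zs
  ⊆-++⁻ [] xs⊆zs = [] , _ , refl , [] , xs⊆zs
  ⊆-++⁻ (y ∷ ys) (_ ∷ʳ xs⊆) with ⊆-++⁻ ys xs⊆
  ... | xs₁ , xs₂ , refl , ⊆ys , ⊆zs = xs₁ , xs₂ , refl , y ∷ʳ ⊆ys , ⊆zs
  ⊆-++⁻ (y ∷ ys) (refl ∷ xs⊆) with ⊆-++⁻ ys xs⊆
  ... | xs₁ , xs₂ , refl , ⊆ys , ⊆zs = y ∷ xs₁ , xs₂ , refl , refl ∷ ⊆ys , ⊆zs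

  Unique-resp-⊇ : ∀ {xs ys : List A} → xs ⊆ ys → Unique ys → Unique xs
  Unique-resp-⊇ [] u = u
  Unique-resp-⊇ (_ ∷ʳ xs⊆ys) (_ ∷ u) = Unique-resp-⊇ xs⊆ys u
  Unique-resp-⊇ (refl ∷ xs⊆ys) (y∉ys ∷ u) =
    All.tabulate (λ m → All.lookup y∉ys (lookup xs⊆ys m)) ∷ Unique-resp-⊇ xs⊆ys u

⊆-map⁻ : ∀ {A B : Set} (f : A → B) {xs : List B} {ys : List A} → xs ⊆ map f ys →
  Σ (List A) λ zs → zs ⊆ ys × xs ≡ map f zs
⊆-map⁻ f {ys = []} [] = [] , [] , refl
⊆-map⁻ f {ys = y ∷ ys} (_ ∷ʳ xs⊆) with ⊆-map⁻ f xs⊆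
... | zs , zs⊆ , refl = zs , y ∷ʳ zs⊆ , refl
⊆-map⁻ f {ys = y ∷ ys} (refl ∷ xs⊆) with ⊆-map⁻ f xs⊆
... | zs , zs⊆ , refl = y ∷ zs , refl ∷ zs⊆ , refl

∑ : {B : Set} → List B → (B → ℕ) → ℕ
∑ [] f = 0
∑ (x ∷ xs) f = f x + ∑ xs f

infix 8 ∑-syntax

∑-syntax : {B : Set} → List B → (B → ℕ) → ℕ
∑-syntax = ∑

syntax ∑-syntax xs (λ x → e) = ∑[ x ∈ xs ] e

module _ {B : Set} where

  ∑-++ : ∀ (xs ys : List B) f → ∑ (xs ++ ys) f ≡ ∑ xs f + ∑ ys f
  ∑-++ [] ys f = refl
  ∑-++ (x ∷ xs) ys f = trans (cong (_+_ (f x)) (∑-++ xs ys f)) (sym (+-assoc (f x) _ _))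

  ∑-distrib-+ : ∀ (xs : List B) f g → ∑[ x ∈ xs ] (f x + g x) ≡ ∑ xs f + ∑ xs g
  ∑-distrib-+ [] f g = refl
  ∑-distrib-+ (x ∷ xs) f g rewrite ∑-distrib-+ xs f g = interchange (f x) (g x) (∑ xs f) (∑ xs g)
    where
    interchange : ∀ a b c d → a + b + (c + d) ≡ a + c + (b + d)
    interchange = ℕ-Solver.solve-∀

  ∑-cong : ∀ (xs : List B) {f g} → (∀ x → x ∈ xs → f x ≡ g x) → ∑ xs f ≡ ∑ xs g
  ∑-cong [] _ = refl
  ∑-cong (x ∷ xs) f≡g = cong₂ _+_ (f≡g x (here refl)) (∑-cong xs (λ y m → f≡g y (there m)))

  ∑-mono : ∀ (xs : List B) {f g} → (∀ x → x ∈ xs → f x ≤ g x) → ∑ xs f ≤ ∑ xs g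
  ∑-mono [] _ = z≤n
  ∑-mono (x ∷ xs) f≤g = +-mono-≤ (f≤g x (here refl)) (∑-mono xs (λ y m → f≤g y (there m)))

  ∑-zero : ∀ (xs : List B) {f} → (∀ x → f x ≡ 0) → ∑ xs f ≡ 0
  ∑-zero [] _ = refl
  ∑-zero (x ∷ xs) f≡0 rewrite f≡0 x = ∑-zero xs f≡0

  ∑-const : ∀ (xs : List B) c → ∑[ x ∈ xs ] c ≡ length xs * c
  ∑-const [] c = refl
  ∑-const (x ∷ xs) c = cong (_+_ c) (∑-const xs c)

  ∑-mono-+ : ∀ (xs : List B) {f g} c → (∀ x → x ∈ xs → f x + c ≤ g x) → ∑ xs f + length xs * c ≤ ∑ xs g
  ∑-mono-+ xs {f} {g} c f+c≤g = begin
    ∑ xs f + length xs * c       ≡⟨ cong (_+_ (∑ xs f)) (sym (∑-const xs c)) ⟩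
    ∑ xs f + ∑[ x ∈ xs ] c       ≡⟨ sym (∑-distrib-+ xs f (λ _ → c)) ⟩
    ∑[ x ∈ xs ] (f x + c)        ≤⟨ ∑-mono xs f+c≤g ⟩
    ∑ xs g                       ∎
    where open ≤-Reasoning

  ∑-*ˡ : ∀ (xs : List B) c f → ∑[ x ∈ xs ] (c * f x) ≡ c * ∑ xs f
  ∑-*ˡ [] c f = sym (*-zeroʳ c)
  ∑-*ˡ (x ∷ xs) c f = trans (cong (_+_ (c * f x)) (∑-*ˡ xs c f)) (sym (*-distribˡ-+ c (f x) (∑ xs f)))

  ∑-map : {C : Set} (h : C → B) (xs : List C) (f : B → ℕ) → ∑ (map h xs) f ≡ ∑[ x ∈ xs ] f (h x)
  ∑-map h [] f = refl
  ∑-map h (x ∷ xs) f = cong (_+_ (f (h x))) (∑-map h xs f)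

∑-comm : {B C : Set} (xs : List B) (ys : List C) (g : B → C → ℕ) →
  ∑[ x ∈ xs ] ∑ ys (g x) ≡ ∑[ y ∈ ys ] ∑[ x ∈ xs ] g x y
∑-comm [] ys g = sym (∑-zero ys (λ _ → refl))
∑-comm (x ∷ xs) ys g =
  trans (cong (_+_ (∑ ys (g x))) (∑-comm xs ys g)) (sym (∑-distrib-+ ys (g x) (λ y → ∑[ x′ ∈ xs ] g x′ y)))

indicator : {P : Set} → Dec P → ℕ
indicator (yes _) = 1
indicator (no _) = 0

count : {A : Set} {P : A → Set} → Decidable P → List A → ℕ
count P? xs = ∑[ x ∈ xs ] indicator (P? x)

module _ {A : Set} {P : A → Set} (P? : Decidable P) where

  length-filter≡count : ∀ xs → length (filter P? xs) ≡ count P? xs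
  length-filter≡count [] = refl
  length-filter≡count (x ∷ xs) with P? x
  ... | yes _ = cong suc (length-filter≡count xs)
  ... | no _ = length-filter≡count xs

  count≤length : ∀ xs → count P? xs ≤ length xs
  count≤length [] = z≤n
  count≤length (x ∷ xs) with P? x
  ... | yes _ = s≤s (count≤length xs)
  ... | no _ = m≤n⇒m≤1+n (count≤length xs)

  count-pos : ∀ {a xs} → a ∈ xs → P a → 1 ≤ count P? xs
  count-pos {xs = x ∷ xs} (here refl) pa with P? x
  ... | yes _ = s≤s z≤n
  ... | no ¬pa = ⊥-elim (¬pa pa)
  count-pos {xs = x ∷ xs} (there m) pa = ≤-trans (count-pos m pa) (m≤n+m _ (indicator (P? x)))

  count-pos⁻ : ∀ xs → 1 ≤ count P? xs → Σ A λ x → x ∈ xs × P x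
  count-pos⁻ (x ∷ xs) pos with P? x
  ... | yes px = x , here refl , px
  ... | no _ = let (y , y∈xs , py) = count-pos⁻ xs pos in y , there y∈xs , py

  count-zero : ∀ xs → (∀ x → x ∈ xs → ¬ P x) → count P? xs ≡ 0
  count-zero [] _ = refl
  count-zero (x ∷ xs) none with P? x
  ... | yes px = ⊥-elim (none x (here refl) px)
  ... | no _ = count-zero xs (λ y m → none y (there m))

  count-one : ∀ xs → Unique xs → ∀ {a} → a ∈ xs → P a →
    (∀ x y → x ∈ xs → y ∈ xs → P x → P y → x ≡ y) → count P? xs ≡ 1
  count-one (x ∷ xs) (x∉xs ∷ u) a∈xs pa unique with P? x
  ... | yes px = cong suc (count-zero xs λ y y∈xs py → All.lookup x∉xs y∈xs (unique x y (here refl) (there y∈xs) px py))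
  count-one (x ∷ xs) _ (here refl) pa _ | no ¬px = ⊥-elim (¬px pa)
  count-one (x ∷ xs) (_ ∷ u) (there a∈xs) pa unique | no _ =
    count-one xs u a∈xs pa (λ y z y∈xs z∈xs → unique y z (there y∈xs) (there z∈xs))

count-mono : {A : Set} {P Q : A → Set} (P? : Decidable P) (Q? : Decidable Q) (xs : List A) →
  (∀ a → a ∈ xs → P a → Q a) → count P? xs ≤ count Q? xs
count-mono P? Q? [] _ = z≤n
count-mono P? Q? (x ∷ xs) P⇒Q with P? x | Q? x
... | yes _ | yes _ = s≤s (count-mono P? Q? xs (λ a m → P⇒Q a (there m)))
... | yes px | no ¬qx = ⊥-elim (¬qx (P⇒Q x (here refl) px))
... | no _ | yes _ = m≤n⇒m≤1+n (count-mono P? Q? xs (λ a m → P⇒Q a (there m)))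
... | no _ | no _ = count-mono P? Q? xs (λ a m → P⇒Q a (there m))

count-cartesianProduct : {A B : Set} {P : A × B → Set} (P? : Decidable P) (xs : List A) (ys : List B) →
  count P? (cartesianProduct xs ys) ≡ ∑[ x ∈ xs ] count (λ y → P? (x , y)) ys
count-cartesianProduct P? [] ys = refl
count-cartesianProduct P? (x ∷ xs) ys =
  trans (∑-++ (map (x ,_) ys) _ _) (cong₂ _+_ (∑-map (x ,_) ys _) (count-cartesianProduct P? xs ys))

∑-count-partition : {A B : Set} {Q : A → Set} (Q? : Decidable Q) {P : B → A → Set} (P? : ∀ r → Decidable (P r))
  (rs : List B) → Unique rs → (xs : List A) →
  (∀ a → a ∈ xs → Q a → Σ B λ r → r ∈ rs × P r a) →
  (∀ a → a ∈ xs → ∀ r r′ → r ∈ rs → r′ ∈ rs → P r a → P r′ a → r ≡ r′) →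
  (∀ a → a ∈ xs → ¬ Q a → ∀ r → r ∈ rs → ¬ P r a) →
  ∑[ r ∈ rs ] count (P? r) xs ≡ count Q? xs
∑-count-partition Q? P? rs unique-rs xs covered disjoint outside =
  trans (∑-comm rs xs (λ r a → indicator (P? r a))) (∑-cong xs classes)
  where
  classes : ∀ a → a ∈ xs → ∑[ r ∈ rs ] indicator (P? r a) ≡ indicator (Q? a)
  classes a a∈xs with Q? a
  ... | yes qa = let (r , r∈rs , pra) = covered a a∈xs qa in
                 count-one (λ r → P? r a) rs unique-rs r∈rs pra (disjoint a a∈xs)
  ... | no ¬qa = count-zero (λ r → P? r a) rs (outside a a∈xs ¬qa)

indicator-cong : {P Q : Set} → (P → Q) → (Q → P) → (p? : Dec P) (q? : Dec Q) → indicator p? ≡ indicator q?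
indicator-cong P⇒Q Q⇒P (yes _) (yes _) = refl
indicator-cong P⇒Q Q⇒P (yes p) (no ¬q) = ⊥-elim (¬q (P⇒Q p))
indicator-cong P⇒Q Q⇒P (no ¬p) (yes q) = ⊥-elim (¬p (Q⇒P q))
indicator-cong P⇒Q Q⇒P (no _) (no _) = refl

[1‥_] : ℕ → List ℕ
[1‥ zero ] = []
[1‥ suc N ] = 1 ∷ map suc [1‥ N ]

count-[1‥] : ∀ {N k} → k ≤ N → count (_≤? k) [1‥ N ] ≡ k
count-[1‥] {zero} z≤n = refl
count-[1‥] {suc N} {k} k≤N =
  trans (cong (_+_ (indicator (1 ≤? k))) (∑-map suc [1‥ N ] (λ t → indicator (t ≤? k)))) (shift k k≤N)
  where
  shift : ∀ k → k ≤ suc N → indicator (1 ≤? k) + ∑[ t ∈ [1‥ N ] ] indicator (suc t ≤? k) ≡ k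
  shift zero _ = ∑-zero [1‥ N ] λ { zero → refl ; (suc t) → refl }
  shift (suc k) (s≤s k≤N) = cong suc (trans
    (∑-cong [1‥ N ] (λ t _ → indicator-cong ≤-pred s≤s (suc t ≤? suc k) (t ≤? k)))
    (count-[1‥] k≤N))

module Cardinality {A : Set} (_≟_ : DecidableEquality A) where

  card : List A → ℕ
  card xs = length (deduplicate _≟_ xs)

  card-mono : ∀ {xs ys} → xs ⊆ˢ ys → card xs ≤ card ys
  card-mono {xs} xs⊆ys = Unique⇒length≤ (UniqueDec.deduplicate-! _≟_ xs)
    (λ m → ∈-deduplicate⁺ _≟_ (xs⊆ys (∈-deduplicate⁻ _≟_ xs m)))

  card-cong : ∀ {xs ys} → xs ⊆ˢ ys → ys ⊆ˢ xs → card xs ≡ card ys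
  card-cong xs⊆ys ys⊆xs = ≤-antisym (card-mono xs⊆ys) (card-mono ys⊆xs)

  Unique⇒length≤card : ∀ {us xs} → Unique us → us ⊆ˢ xs → length us ≤ card xs
  Unique⇒length≤card u us⊆xs = Unique⇒length≤ u (λ m → ∈-deduplicate⁺ _≟_ (us⊆xs m))

  card≤length : ∀ {xs us} → xs ⊆ˢ us → card xs ≤ length us
  card≤length {xs} xs⊆us = Unique⇒length≤ (UniqueDec.deduplicate-! _≟_ xs) (λ m → xs⊆us (∈-deduplicate⁻ _≟_ xs m))

  open DecMembership _≟_ using (_∈?_)

  card≡count : (us : List A) → Unique us → (∀ x → x ∈ us) → ∀ xs → card xs ≡ count (_∈? xs) us
  card≡count us unique-us complete xs = trans
    (≤-antisym (card≤length (λ m → ∈-filter⁺ (_∈? xs) (complete _) m))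
               (Unique⇒length≤card (Unique.filter⁺ (_∈? xs) unique-us) (λ m → proj₂ (∈-filter⁻ (_∈? xs) {xs = us} m))))
    (length-filter≡count (_∈? xs) us)


open Cardinality public using (card; card≡count)

card-map-injective : {A B : Set} (_≟A_ : DecidableEquality A) (_≟B_ : DecidableEquality B) (f : A → B) →
  (∀ {x y} → f x ≡ f y → x ≡ y) → ∀ xs → card _≟B_ (map f xs) ≡ card _≟A_ xs
card-map-injective {A} _≟A_ _≟B_ f f-inj xs = ≤-antisym
  (subst (card _≟B_ (map f xs) ≤_) (List.length-map f ys) (card≤length {map f xs} (map-mono (∈-deduplicate⁺ _≟A_))))
  (subst (_≤ card _≟B_ (map f xs)) (List.length-map f ys)
    (Unique⇒length≤card {xs = map f xs} (Unique.map⁺ f-inj (UniqueDec.deduplicate-! _≟A_ xs))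
      (map-mono (∈-deduplicate⁻ _≟A_ xs))))
  where
  open Cardinality _≟B_ using (card≤length; Unique⇒length≤card)
  ys : List A
  ys = deduplicate _≟A_ xs

  map-mono : ∀ {us vs} → us ⊆ˢ vs → map f us ⊆ˢ map f vs
  map-mono us⊆vs m with ∈-map⁻ f m
  ... | _ , u∈us , refl = ∈-map⁺ f (us⊆vs u∈us)

module _ {A : Set} (_≟_ : DecidableEquality A) {P : A → Set} (P? : Decidable P) (us : List A) (complete : ∀ x → x ∈ us) where
  open DecMembership _≟_ using (_∈?_)

  pigeonhole : ∀ {vs} → Unique vs → (∀ {x} → x ∈ vs → P x) → count P? us ≤ length vs → ∀ {x} → P x → x ∈ vs
  pigeonhole {vs} unique-vs vs-P count≤ {x} px with x ∈? vs
  ... | yes x∈vs = x∈vs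
  ... | no x∉vs = ⊥-elim (<-irrefl refl (≤-trans more count≤))
    where
    more : suc (length vs) ≤ count P? us
    more = subst (suc (length vs) ≤_) (length-filter≡count P? us)
      (Unique⇒length≤ {xs = x ∷ vs} (All.tabulate (λ y∈vs x≡y → x∉vs (subst (_∈ vs) (sym x≡y) y∈vs)) ∷ unique-vs)
        λ { (here refl) → ∈-filter⁺ P? (complete x) px ; (there y∈vs) → ∈-filter⁺ P? (complete _) (vs-P y∈vs) })

-- Arithmetic in Γ = ℤ/p × ℤ/q

infixl 6 _+²_

_+²_ : ℤ × ℤ → ℤ × ℤ → ℤ × ℤ
x +² y = (proj₁ x +ℤ proj₁ y , proj₂ x +ℤ proj₂ y)

-²_ : ℤ × ℤ → ℤ × ℤ
-² x = (- proj₁ x , - proj₂ x)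

0² : ℤ × ℤ
0² = (+ 0 , + 0)

+²-assoc : ∀ x y z → x +² y +² z ≡ x +² (y +² z)
+²-assoc x y z = cong₂ _,_ (assoc (proj₁ x) (proj₁ y) (proj₁ z)) (assoc (proj₂ x) (proj₂ y) (proj₂ z))
  where
  assoc : ∀ a b c → a +ℤ b +ℤ c ≡ a +ℤ (b +ℤ c)
  assoc = solve-∀

+²-identityˡ : ∀ x → 0² +² x ≡ x
+²-identityˡ x = cong₂ _,_ (identity (proj₁ x)) (identity (proj₂ x))
  where
  identity : ∀ a → + 0 +ℤ a ≡ a
  identity = solve-∀

+²-identityʳ : ∀ x → x +² 0² ≡ x
+²-identityʳ x = cong₂ _,_ (identity (proj₁ x)) (identity (proj₂ x))
  where
  identity : ∀ a → a +ℤ + 0 ≡ a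
  identity = solve-∀

+²-inverse-cancel : ∀ x y → x ≡ x +² y +² -² y
+²-inverse-cancel x y = cong₂ _,_ (cancel (proj₁ x) (proj₁ y)) (cancel (proj₂ x) (proj₂ y))
  where
  cancel : ∀ a b → a ≡ a +ℤ b +ℤ - b
  cancel = solve-∀

ι : ∀ {p q} → Γ p q → ℤ × ℤ
ι (a , b) = (+ toℕ a , + toℕ b)

module Congruence (P : ℕ) where

  infix 4 _≈_

  record _≈_ (x y : ℤ) : Set where
    constructor mk≈
    field divides-difference : + P ∣ x -ℤ y

  open _≈_

  ≈-reflexive : ∀ {x y} → x ≡ y → x ≈ y
  ≈-reflexive {x} refl = mk≈ (divides (+ 0) (ℤ.+-inverseʳ x))

  ≈-sym : ∀ {x y} → x ≈ y → y ≈ x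
  ≈-sym {x} {y} (mk≈ d) = mk≈ (subst (+ P ∣_) (flip x y) (∣m⇒∣-m d))
    where
    flip : ∀ x y → - (x -ℤ y) ≡ y -ℤ x
    flip = solve-∀

  ≈-trans : ∀ {x y z} → x ≈ y → y ≈ z → x ≈ z
  ≈-trans {x} {y} {z} (mk≈ d) (mk≈ d′) = mk≈ (subst (+ P ∣_) (telescope x y z) (∣m∣n⇒∣m+n d d′))
    where
    telescope : ∀ x y z → (x -ℤ y) +ℤ (y -ℤ z) ≡ x -ℤ z
    telescope = solve-∀

  +-cong : ∀ {x y u v} → x ≈ y → u ≈ v → x +ℤ u ≈ y +ℤ v
  +-cong {x} {y} {u} {v} (mk≈ d) (mk≈ d′) = mk≈ (subst (+ P ∣_) (regroup x y u v) (∣m∣n⇒∣m+n d d′))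
    where
    regroup : ∀ x y u v → (x -ℤ y) +ℤ (u -ℤ v) ≡ (x +ℤ u) -ℤ (y +ℤ v)
    regroup = solve-∀

  +-multiple : ∀ x k → x +ℤ k *ℤ + P ≈ x
  +-multiple x k = mk≈ (divides k (cancel x k (+ P)))
    where
    cancel : ∀ x k p → (x +ℤ k *ℤ p) -ℤ x ≡ k *ℤ p
    cancel = solve-∀

  +-cancelˡ : ∀ {x y} → x ≈ x +ℤ y → y ≈ + 0
  +-cancelˡ {x} {y} (mk≈ d) = mk≈ (subst (+ P ∣_) (cancel x y) (∣m⇒∣-m d))
    where
    cancel : ∀ x y → - (x -ℤ (x +ℤ y)) ≡ y -ℤ + 0
    cancel = solve-∀

  +-cancelʳ : ∀ {x y z} → x +ℤ z ≈ y +ℤ z → x ≈ y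
  +-cancelʳ {x} {y} {z} (mk≈ d) = mk≈ (subst (+ P ∣_) (cancel x y z) d)
    where
    cancel : ∀ x y z → (x +ℤ z) -ℤ (y +ℤ z) ≡ x -ℤ y
    cancel = solve-∀

  ∣⇒≈0 : ∀ {x} → + P Unsigned.∣ x → x ≈ + 0
  ∣⇒≈0 {x} d = mk≈ (subst (+ P ∣_) (sym (ℤ.+-identityʳ x)) (∣ᵤ⇒∣ d))

  ≈0⇒∣ : ∀ {x} → x ≈ + 0 → + P Unsigned.∣ x
  ≈0⇒∣ {x} (mk≈ d) = ∣⇒∣ᵤ (subst (+ P ∣_) (ℤ.+-identityʳ x) d)

  module _ .{{_ : NonZero P}} where

    reduce : ℤ → Fin P
    reduce x = fromℕ< (n%ℕd<d x P)

    reduce-≈ : ∀ x → + toℕ (reduce x) ≈ x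
    reduce-≈ x = ≈-sym (subst (_≈ + toℕ (reduce x)) (sym x≡) (+-multiple (+ toℕ (reduce x)) (x /ℕ P)))
      where
      x≡ : x ≡ + toℕ (reduce x) +ℤ (x /ℕ P) *ℤ + P
      x≡ = trans (a≡a%ℕn+[a/ℕn]*n x P) (cong (λ r → + r +ℤ (x /ℕ P) *ℤ + P) (sym (Fin.toℕ-fromℕ< (n%ℕd<d x P))))

    mod-≈ : ∀ m → + toℕ (m mod P) ≈ + m
    mod-≈ m = subst (λ k → + k ≈ + m) (trans (Fin.toℕ-fromℕ< _) (sym (Fin.toℕ-fromℕ< _))) (reduce-≈ (+ m))

    private
      ≈⇒≡-ordered : ∀ (a b : Fin P) → toℕ b ≤ toℕ a → + toℕ a ≈ + toℕ b → toℕ a ≡ toℕ b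
      ≈⇒≡-ordered a b b≤a (mk≈ d) =
        ≤-antisym (m∸n≡0⇒m≤n (small-multiple (toℕ a ∸ toℕ b) P∣a∸b a∸b<P)) b≤a
        where
        P∣a∸b : P ℕ.∣ toℕ a ∸ toℕ b
        P∣a∸b = ∣⇒∣ᵤ (subst (+ P ∣_) (trans (ℤ.m-n≡m⊖n (toℕ a) (toℕ b)) (ℤ.⊖-≥ b≤a)) d)
        a∸b<P : toℕ a ∸ toℕ b < P
        a∸b<P = ≤-<-trans (m∸n≤m (toℕ a) (toℕ b)) (Fin.toℕ<n a)
        small-multiple : ∀ k → P ℕ.∣ k → k < P → k ≡ 0
        small-multiple zero _ _ = refl
        small-multiple (suc k) P∣k k<P = ⊥-elim (ℕ.>⇒∤ k<P P∣k)

    toℕ-≈-injective : ∀ (a b : Fin P) → + toℕ a ≈ + toℕ b → a ≡ b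
    toℕ-≈-injective a b a≈b with ≤-total (toℕ b) (toℕ a)
    ... | inj₁ b≤a = Fin.toℕ-injective (≈⇒≡-ordered a b b≤a a≈b)
    ... | inj₂ a≤b = Fin.toℕ-injective (sym (≈⇒≡-ordered b a a≤b (≈-sym a≈b)))

  double≈0⇒≈0 : Prime P → P ≢ 2 → ∀ x → x +ℤ x ≈ + 0 → x ≈ + 0
  double≈0⇒≈0 P-prime P≢2 x 2x≈0 = ∣⇒≈0 (P∣x (euclidsLemma 2 ∣ x ∣ P-prime P∣2x))
    where
    open Unsigned using () renaming (_∣_ to _∣ᵤ_)
    double : ∀ x → x +ℤ x ≡ + 2 *ℤ x
    double = solve-∀
    P∣2x : P ℕ.∣ 2 Data.Nat.* ∣ x ∣
    P∣2x = subst (P ℕ.∣_) (trans (cong ∣_∣ (double x)) (ℤ.abs-* (+ 2) x)) (≈0⇒∣ 2x≈0)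
    P∣x : P ℕ.∣ 2 ⊎ P ℕ.∣ ∣ x ∣ → + P ∣ᵤ x
    P∣x (inj₂ P∣x) = P∣x
    P∣x (inj₁ P∣2) = ⊥-elim (P≢2 (≤-antisym (ℕ.∣⇒≤ P∣2) (nonTrivial⇒n>1 P {{prime⇒nonTrivial P-prime}})))

module Congruence² (p q : ℕ) where
  private
    module ≈ₚ = Congruence p
    module ≈q = Congruence q

  infix 4 _≈²_

  _≈²_ : ℤ × ℤ → ℤ × ℤ → Set
  x ≈² y = proj₁ x ≈ₚ.≈ proj₁ y × proj₂ x ≈q.≈ proj₂ y

  ≈²-reflexive : ∀ {x y} → x ≡ y → x ≈² y
  ≈²-reflexive refl = ≈ₚ.≈-reflexive refl , ≈q.≈-reflexive refl

  ≈²-sym : ∀ {x y} → x ≈² y → y ≈² x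
  ≈²-sym (x₁ , x₂) = ≈ₚ.≈-sym x₁ , ≈q.≈-sym x₂

  ≈²-trans : ∀ {x y z} → x ≈² y → y ≈² z → x ≈² z
  ≈²-trans (x₁ , x₂) (y₁ , y₂) = ≈ₚ.≈-trans x₁ y₁ , ≈q.≈-trans x₂ y₂

  ≈²-setoid : Setoid _ _
  ≈²-setoid = record
    { Carrier = ℤ × ℤ ; _≈_ = _≈²_
    ; isEquivalence = record { refl = ≈²-reflexive refl ; sym = ≈²-sym ; trans = ≈²-trans } }

  +²-cong : ∀ {x y u v} → x ≈² y → u ≈² v → x +² u ≈² y +² v
  +²-cong (x₁ , x₂) (u₁ , u₂) = ≈ₚ.+-cong x₁ u₁ , ≈q.+-cong x₂ u₂

  +²-congˡ : ∀ x {y z} → y ≈² z → x +² y ≈² x +² z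
  +²-congˡ x = +²-cong (≈²-reflexive {x} refl)

  +²-congʳ : ∀ z {x y} → x ≈² y → x +² z ≈² y +² z
  +²-congʳ z x≈y = +²-cong x≈y (≈²-reflexive {z} refl)

  +²-cancelˡ : ∀ {x y} → x ≈² x +² y → y ≈² 0²
  +²-cancelˡ (x₁ , x₂) = ≈ₚ.+-cancelˡ x₁ , ≈q.+-cancelˡ x₂

  +²-cancelʳ : ∀ {x y z} → x +² z ≈² y +² z → x ≈² y
  +²-cancelʳ (x₁ , x₂) = ≈ₚ.+-cancelʳ x₁ , ≈q.+-cancelʳ x₂

  Divisible² : ℤ × ℤ → Set
  Divisible² x = (+ p Unsigned.∣ proj₁ x) × (+ q Unsigned.∣ proj₂ x)

  Divisible²⇒≈²0 : ∀ {x} → Divisible² x → x ≈² 0²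
  Divisible²⇒≈²0 (d₁ , d₂) = ≈ₚ.∣⇒≈0 d₁ , ≈q.∣⇒≈0 d₂

  ≈²0⇒Divisible² : ∀ {x} → x ≈² 0² → Divisible² x
  ≈²0⇒Divisible² (x₁ , x₂) = ≈ₚ.≈0⇒∣ x₁ , ≈q.≈0⇒∣ x₂

  double≈²0⇒≈²0 : Prime p → Prime q → p ≢ 2 → q ≢ 2 → ∀ x → x +² x ≈² 0² → x ≈² 0²
  double≈²0⇒≈²0 p-prime q-prime p≢2 q≢2 x (x₁ , x₂) =
    ≈ₚ.double≈0⇒≈0 p-prime p≢2 (proj₁ x) x₁ , ≈q.double≈0⇒≈0 q-prime q≢2 (proj₂ x) x₂

  module _ .{{_ : NonZero p}} .{{_ : NonZero q}} where

    ι-⊕ : ∀ (a c : Γ p q) → ι (a ⊕[ p , q ] c) ≈² ι a +² ι c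
    ι-⊕ (a₁ , a₂) (c₁ , c₂) =
      ≈ₚ.≈-trans (≈ₚ.mod-≈ (toℕ a₁ Data.Nat.+ toℕ c₁)) (≈ₚ.≈-reflexive (ℤ.pos-+ (toℕ a₁) (toℕ c₁))) ,
      ≈q.≈-trans (≈q.mod-≈ (toℕ a₂ Data.Nat.+ toℕ c₂)) (≈q.≈-reflexive (ℤ.pos-+ (toℕ a₂) (toℕ c₂)))

    ⊕-shift : ∀ a c r → ι (a ⊕[ p , q ] c) +² r ≈² ι a +² (ι c +² r)
    ⊕-shift a c r = ≈²-trans (+²-congʳ r (ι-⊕ a c)) (≈²-reflexive (+²-assoc (ι a) (ι c) r))

    ⊕-unshift : ∀ a c r → ι a +² r ≈² ι (a ⊕[ p , q ] c) +² (-² ι c +² r)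
    ⊕-unshift a c r = ≈²-trans (≈²-reflexive (cong (_+² r) (+²-inverse-cancel (ι a) (ι c))))
      (≈²-trans (+²-congʳ r (+²-congʳ (-² ι c) (≈²-sym (ι-⊕ a c))))
      (≈²-reflexive (+²-assoc (ι (a ⊕[ p , q ] c)) (-² ι c) r)))

    ι-injective : ∀ {a b : Γ p q} → ι a ≈² ι b → a ≡ b
    ι-injective {a₁ , a₂} {b₁ , b₂} (x₁ , x₂) =
      cong₂ _,_ (≈ₚ.toℕ-≈-injective a₁ b₁ x₁) (≈q.toℕ-≈-injective a₂ b₂ x₂)

    ⊕-cancelʳ : ∀ {a b} (c : Γ p q) → a ⊕[ p , q ] c ≡ b ⊕[ p , q ] c → a ≡ b
    ⊕-cancelʳ {a} {b} c a⊕c≡b⊕c = ι-injective (+²-cancelʳ {z = ι c} (≈²-trans (≈²-sym (ι-⊕ a c))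
      (≈²-trans (≈²-reflexive (cong ι a⊕c≡b⊕c)) (ι-⊕ b c))))

    reduce² : ℤ × ℤ → Γ p q
    reduce² x = (≈ₚ.reduce (proj₁ x) , ≈q.reduce (proj₂ x))

    ι-reduce² : ∀ x → ι (reduce² x) ≈² x
    ι-reduce² x = ≈ₚ.reduce-≈ (proj₁ x) , ≈q.reduce-≈ (proj₂ x)

-- Walks and their gains

module _ {n p q : ℕ} {S : List (CEdge n p q)} where

  tl∈endpoints : ∀ {e} → e ∈ S → tl e ∈ endpoints S
  tl∈endpoints e∈S = ∈-++⁺ˡ (∈-map⁺ tl e∈S)

  hd∈endpoints : ∀ {e} → e ∈ S → hd e ∈ endpoints S
  hd∈endpoints e∈S = ∈-++⁺ʳ (map tl S) (∈-map⁺ hd e∈S)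

  ∈-endpoints⁻ : ∀ {v} → v ∈ endpoints S → Σ (CEdge n p q) λ e → e ∈ S × (tl e ≡ v ⊎ hd e ≡ v)
  ∈-endpoints⁻ m with ∈-++⁻ (map tl S) m
  ... | inj₁ m₁ = let (e , e∈S , v≡) = ∈-map⁻ tl m₁ in e , e∈S , inj₁ (sym v≡)
  ... | inj₂ m₂ = let (e , e∈S , v≡) = ∈-map⁻ hd m₂ in e , e∈S , inj₂ (sym v≡)

endpoints-mono : ∀ {n p q} {S S′ : List (CEdge n p q)} → S ⊆ˢ S′ → endpoints S ⊆ˢ endpoints S′
endpoints-mono S⊆S′ m with ∈-endpoints⁻ m
... | e , e∈S , inj₁ refl = tl∈endpoints (S⊆S′ e∈S)
... | e , e∈S , inj₂ refl = hd∈endpoints (S⊆S′ e∈S)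

module _ {n p q : ℕ} {S : List (CEdge n p q)} where

  infixr 5 _++ʷ_

  _++ʷ_ : ∀ {u v w} → Walk S u v → Walk S v w → Walk S u w
  stop ++ʷ w′ = w′
  fwd e m w ++ʷ w′ = fwd e m (w ++ʷ w′)
  bwd e m w ++ʷ w′ = bwd e m (w ++ʷ w′)

  reverseʷ : ∀ {u v} → Walk S u v → Walk S v u
  reverseʷ stop = stop
  reverseʷ (fwd e m w) = reverseʷ w ++ʷ bwd e m stop
  reverseʷ (bwd e m w) = reverseʷ w ++ʷ fwd e m stop

  ρ-fwd : ∀ e (m : e ∈ S) {v} (w : Walk S (hd e) v) → ρℤ (fwd e m w) ≡ ι (col e) +² ρℤ w
  ρ-fwd (_ , _ , _) m w = refl

  ρ-bwd : ∀ e (m : e ∈ S) {v} (w : Walk S (tl e) v) → ρℤ (bwd e m w) ≡ -² ι (col e) +² ρℤ w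
  ρ-bwd (_ , _ , _) m w = refl

  ρ-++ : ∀ {u v w} (w₁ : Walk S u v) (w₂ : Walk S v w) → ρℤ (w₁ ++ʷ w₂) ≡ ρℤ w₁ +² ρℤ w₂
  ρ-++ stop w₂ = sym (+²-identityˡ (ρℤ w₂))
  ρ-++ (fwd e m w₁) w₂ = begin
    ρℤ (fwd e m (w₁ ++ʷ w₂))        ≡⟨ ρ-fwd e m (w₁ ++ʷ w₂) ⟩
    ι (col e) +² ρℤ (w₁ ++ʷ w₂)     ≡⟨ cong (ι (col e) +²_) (ρ-++ w₁ w₂) ⟩
    ι (col e) +² (ρℤ w₁ +² ρℤ w₂)   ≡⟨ sym (+²-assoc (ι (col e)) (ρℤ w₁) (ρℤ w₂)) ⟩
    ι (col e) +² ρℤ w₁ +² ρℤ w₂     ≡⟨ cong (_+² ρℤ w₂) (sym (ρ-fwd e m w₁)) ⟩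
    ρℤ (fwd e m w₁) +² ρℤ w₂        ∎
    where open ≡-Reasoning
  ρ-++ (bwd e m w₁) w₂ = begin
    ρℤ (bwd e m (w₁ ++ʷ w₂))         ≡⟨ ρ-bwd e m (w₁ ++ʷ w₂) ⟩
    -² ι (col e) +² ρℤ (w₁ ++ʷ w₂)   ≡⟨ cong (-² ι (col e) +²_) (ρ-++ w₁ w₂) ⟩
    -² ι (col e) +² (ρℤ w₁ +² ρℤ w₂) ≡⟨ sym (+²-assoc (-² ι (col e)) (ρℤ w₁) (ρℤ w₂)) ⟩
    -² ι (col e) +² ρℤ w₁ +² ρℤ w₂   ≡⟨ cong (_+² ρℤ w₂) (sym (ρ-bwd e m w₁)) ⟩
    ρℤ (bwd e m w₁) +² ρℤ w₂         ∎
    where open ≡-Reasoning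

  ρ-reverse : ∀ {u v} (w : Walk S u v) → ρℤ (reverseʷ w) ≡ -² ρℤ w
  ρ-reverse stop = refl
  ρ-reverse (fwd e@(_ , _ , (a , b)) m w)
    rewrite ρ-++ (reverseʷ w) (bwd e m (stop {v = tl e})) | ρ-reverse w =
      cong₂ _,_ (undo (+ toℕ a) (proj₁ (ρℤ w))) (undo (+ toℕ b) (proj₂ (ρℤ w)))
    where
    undo : ∀ c x → - x +ℤ (- c +ℤ + 0) ≡ - (c +ℤ x)
    undo = solve-∀
  ρ-reverse (bwd e@(_ , _ , (a , b)) m w)
    rewrite ρ-++ (reverseʷ w) (fwd e m (stop {v = hd e})) | ρ-reverse w =
      cong₂ _,_ (undo (+ toℕ a) (proj₁ (ρℤ w))) (undo (+ toℕ b) (proj₂ (ρℤ w)))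
    where
    undo : ∀ c x → - x +ℤ (c +ℤ + 0) ≡ - (- c +ℤ x)
    undo = solve-∀

  walk-source : ∀ {u v} → Walk S u v → u ≡ v ⊎ u ∈ endpoints S
  walk-source stop = inj₁ refl
  walk-source (fwd e m w) = inj₂ (tl∈endpoints m)
  walk-source (bwd e m w) = inj₂ (hd∈endpoints m)

walk-weaken : ∀ {n p q} {S S′ : List (CEdge n p q)} → S ⊆ˢ S′ → ∀ {u v} → Walk S u v → Walk S′ u v
walk-weaken S⊆S′ stop = stop
walk-weaken S⊆S′ (fwd e m w) = fwd e (S⊆S′ m) (walk-weaken S⊆S′ w)
walk-weaken S⊆S′ (bwd e m w) = bwd e (S⊆S′ m) (walk-weaken S⊆S′ w)

module _ {n p q : ℕ} where

  WalkVia : List (CEdge n p q) → CEdge n p q → Fin n → Fin n → Set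
  WalkVia S e u v = Walk S u v ⊎ (Walk S u (tl e) × Walk S (hd e) v) ⊎ (Walk S u (hd e) × Walk S (tl e) v)

  Walk-∷⁻ : ∀ {e S u v} → Walk (e ∷ S) u v → WalkVia S e u v
  Walk-∷⁻ stop = inj₁ stop
  Walk-∷⁻ (fwd _ (here refl) w) with Walk-∷⁻ w
  ... | inj₁ w′ = inj₂ (inj₁ (stop , w′))
  ... | inj₂ (inj₁ (w₁ , w₂)) = inj₁ (reverseʷ w₁ ++ʷ w₂)
  ... | inj₂ (inj₂ (_ , w₂)) = inj₁ w₂
  Walk-∷⁻ (fwd e (there m) w) with Walk-∷⁻ w
  ... | inj₁ w′ = inj₁ (fwd e m w′)
  ... | inj₂ (inj₁ (w₁ , w₂)) = inj₂ (inj₁ (fwd e m w₁ , w₂))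
  ... | inj₂ (inj₂ (w₁ , w₂)) = inj₂ (inj₂ (fwd e m w₁ , w₂))
  Walk-∷⁻ (bwd _ (here refl) w) with Walk-∷⁻ w
  ... | inj₁ w′ = inj₂ (inj₂ (stop , w′))
  ... | inj₂ (inj₁ (_ , w₂)) = inj₁ w₂
  ... | inj₂ (inj₂ (w₁ , w₂)) = inj₁ (reverseʷ w₁ ++ʷ w₂)
  Walk-∷⁻ (bwd e (there m) w) with Walk-∷⁻ w
  ... | inj₁ w′ = inj₁ (bwd e m w′)
  ... | inj₂ (inj₁ (w₁ , w₂)) = inj₂ (inj₁ (bwd e m w₁ , w₂))
  ... | inj₂ (inj₂ (w₁ , w₂)) = inj₂ (inj₂ (bwd e m w₁ , w₂))

  Walk-∷⁺ : ∀ {e S u v} → WalkVia S e u v → Walk (e ∷ S) u v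
  Walk-∷⁺ (inj₁ w) = walk-weaken there w
  Walk-∷⁺ {e} (inj₂ (inj₁ (w₁ , w₂))) = walk-weaken there w₁ ++ʷ fwd e (here refl) (walk-weaken there w₂)
  Walk-∷⁺ {e} (inj₂ (inj₂ (w₁ , w₂))) = walk-weaken there w₁ ++ʷ bwd e (here refl) (walk-weaken there w₂)

  walk? : ∀ (S : List (CEdge n p q)) u v → Dec (Walk S u v)
  walk? [] u v with u Fin.≟ v
  ... | yes refl = yes stop
  ... | no u≢v = no λ { stop → u≢v refl }
  walk? (e ∷ S) u v = map′ Walk-∷⁺ Walk-∷⁻
    (walk? S u v ⊎-dec (walk? S u (tl e) ×-dec walk? S (hd e) v) ⊎-dec (walk? S u (hd e) ×-dec walk? S (tl e) v))

-- Connected components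

¬¬-decide : ∀ {n} {P : Fin n → Set} → ¬ ¬ (∀ v → Dec (P v))
¬¬-decide {zero} = pure λ ()
¬¬-decide {suc n} {P} = do
  d₀ ← ¬¬-excluded-middle
  ds ← ¬¬-decide {n} {λ v → P (Fin.suc v)}
  pure λ { Fin.zero → d₀ ; (Fin.suc v) → ds v }

Transversal : ∀ {n p q} → List (CEdge n p q) → List (Fin n) → Set
Transversal S R =
    All (_∈ endpoints S) R
  × Unique R
  × (∀ r r′ → r ∈ R → r′ ∈ R → r ≢ r′ → ¬ Walk S r r′)
  × (∀ v → v ∈ endpoints S → Any (Walk S v) R)

transversal-cong : ∀ {n p q} {S : List (CEdge n p q)} {R R′} → Transversal S R → Unique R′ →
  (∀ {x} → x ∈ R → x ∈ R′) → (∀ {x} → x ∈ R′ → x ∈ R) → Transversal S R′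
transversal-cong (in-S , _ , separated , covers) unique-R′ R⊆R′ R′⊆R =
    All.tabulate (λ m → All.lookup in-S (R′⊆R m))
  , unique-R′
  , (λ r r′ m m′ → separated r r′ (R′⊆R m) (R′⊆R m′))
  , (λ v v∈S → let (r , r∈R , w) = find (covers v v∈S) in lose (R⊆R′ r∈R) w)

module Representatives {n p q : ℕ} (S : List (CEdge n p q)) where

  Minimal : Fin n → Set
  Minimal r = ∀ u → Walk S r u → toℕ r ≤ toℕ u

  minimal? : ∀ r → Dec (Minimal r)
  minimal? r = Fin.all? λ u → walk? S r u →-dec (toℕ r ≤? toℕ u)

  IsRepresentative : Fin n → Set
  IsRepresentative r = r ∈ endpoints S × Minimal r

  isRepresentative? : ∀ r → Dec (IsRepresentative r)
  isRepresentative? r = (r ∈? endpoints S) ×-dec minimal? r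
    where open DecMembership Fin._≟_ using (_∈?_)

  representatives : List (Fin n)
  representatives = filter isRepresentative? (allFin n)

  private
    smaller-neighbour : ∀ {v} → ¬ Minimal v → Σ (Fin n) λ u → Walk S v u × toℕ u < toℕ v
    smaller-neighbour {v} ¬min with Fin.¬∀⟶∃¬ n _ (λ u → walk? S v u →-dec (toℕ v ≤? toℕ u)) ¬min
    ... | u , ¬min-u with walk? S v u | toℕ v ≤? toℕ u
    ...   | yes w | yes v≤u = ⊥-elim (¬min-u (λ _ → v≤u))
    ...   | yes w | no v≰u = u , w , ≰⇒> v≰u
    ...   | no ¬w | _ = ⊥-elim (¬min-u (λ w → ⊥-elim (¬w w)))

    reach : ∀ k v → toℕ v < k → v ∈ endpoints S → Σ (Fin n) λ r → IsRepresentative r × Walk S v r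
    reach (suc k) v v<k v∈S with minimal? v
    ... | yes min = v , (v∈S , min) , stop
    ... | no ¬min with smaller-neighbour ¬min
    ...   | u , w , u<v with walk-source (reverseʷ w)
    ...     | inj₁ refl = ⊥-elim (<-irrefl refl u<v)
    ...     | inj₂ u∈S = let (r , rep , w′) = reach k u (≤-trans u<v (≤-pred v<k)) u∈S in r , rep , w ++ʷ w′

  representatives-transversal : Transversal S representatives
  representatives-transversal =
      All.tabulate (λ m → proj₁ (proj₂ (∈-filter⁻ isRepresentative? {xs = allFin n} m)))
    , Unique.filter⁺ isRepresentative? (Unique.allFin⁺ n)
    , separated
    , λ v v∈S → let (r , rep , w) = reach (suc (toℕ v)) v Data.Nat.Properties.≤-refl v∈S in
                lose (∈-filter⁺ isRepresentative? (∈-allFin r) rep) w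
    where
    minimal : ∀ {r} → r ∈ representatives → Minimal r
    minimal m = proj₂ (proj₂ (∈-filter⁻ isRepresentative? {xs = allFin n} m))
    separated : ∀ r r′ → r ∈ representatives → r′ ∈ representatives → r ≢ r′ → ¬ Walk S r r′
    separated r r′ m m′ r≢r′ w = r≢r′ (Fin.toℕ-injective (≤-antisym (minimal m r′ w) (minimal m′ r (reverseʷ w))))

  module Classified (rank-zero? : ∀ v → Dec (RankZero p q S v)) where

    rank0 : List (Fin n)
    rank0 = filter rank-zero? representatives

    rank1 : List (Fin n)
    rank1 = filter (λ v → ¬? (rank-zero? v)) representatives

    private
      classify : ∀ {x} → x ∈ representatives → x ∈ rank0 ++ rank1
      classify {x} m with rank-zero? x
      ... | yes rz = ∈-++⁺ˡ (∈-filter⁺ rank-zero? m rz)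
      ... | no ¬rz = ∈-++⁺ʳ rank0 (∈-filter⁺ (λ v → ¬? (rank-zero? v)) m ¬rz)

      unclassify : ∀ {x} → x ∈ rank0 ++ rank1 → x ∈ representatives
      unclassify m with ∈-++⁻ rank0 m
      ... | inj₁ m₀ = proj₁ (∈-filter⁻ rank-zero? {xs = representatives} m₀)
      ... | inj₂ m₁ = proj₁ (∈-filter⁻ (λ v → ¬? (rank-zero? v)) {xs = representatives} m₁)

      unique : Unique (rank0 ++ rank1)
      unique = Unique.++⁺ (Unique.filter⁺ _ unique-reps) (Unique.filter⁺ _ unique-reps)
        λ (m₀ , m₁) → proj₂ (∈-filter⁻ (λ v → ¬? (rank-zero? v)) {xs = representatives} m₁)
                        (proj₂ (∈-filter⁻ rank-zero? {xs = representatives} m₀))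
        where unique-reps = proj₁ (proj₂ representatives-transversal)

    components : Components p q S rank0 rank1
    components =
      let (in-S , unique′ , separated , covers) = transversal-cong representatives-transversal unique classify unclassify
      in in-S , unique′ , separated , covers
       , All.tabulate (λ m → proj₂ (∈-filter⁻ rank-zero? {xs = representatives} m))
       , All.tabulate (λ m → proj₂ (∈-filter⁻ (λ v → ¬? (rank-zero? v)) {xs = representatives} m))

-- RankZero quantifies over all closed walks and is not decided here, so components are only
-- classified under double negation; every use below concludes a negation or a decidable fact.
components-exist : ∀ {n} p q (S : List (CEdge n p q)) → ¬ ¬ (∃₂ λ L0 L1 → Components p q S L0 L1)
components-exist p q S = do
  rank-zero? ← ¬¬-decide
  pure (_ , _ , Representatives.Classified.components S rank-zero?)

module _ {n p q : ℕ} {S : List (CEdge n p q)} {L0 L1 : List (Fin n)} (C : Components p q S L0 L1) {e} (e∈S : e ∈ S) where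

  private
    covers : ∀ v → v ∈ endpoints S → Any (Walk S v) (L0 ++ L1)
    covers = proj₁ (proj₂ (proj₂ (proj₂ C)))

    rank1 : All (λ r → ¬ RankZero p q S r) L1
    rank1 = proj₂ (proj₂ (proj₂ (proj₂ (proj₂ C))))

    representative : Σ (Fin n) (_∈ L0 ++ L1)
    representative = let (r , r∈ , _) = find (covers (tl e) (tl∈endpoints e∈S)) in r , r∈

  components-pos : 1 ≤ 3 * length L0 + length L1
  components-pos with ∈-++⁻ L0 (proj₂ representative)
  ... | inj₁ r∈L0 = ≤-trans (s≤s z≤n) (≤-trans (*-monoʳ-≤ 3 (∈-length r∈L0)) (m≤m+n _ _))
  ... | inj₂ r∈L1 = ≤-trans (∈-length r∈L1) (m≤n+m _ _)

  rank-zero-components : (∀ r → RankZero p q S r) → 3 ≤ 3 * length L0 + length L1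
  rank-zero-components rank-zero with ∈-++⁻ L0 (proj₂ representative)
  ... | inj₁ r∈L0 = ≤-trans (*-monoʳ-≤ 3 (∈-length r∈L0)) (m≤m+n _ _)
  ... | inj₂ r∈L1 = ⊥-elim (All.lookup rank1 r∈L1 (rank-zero (proj₁ representative)))

nVerts≡count : ∀ {n p q} (S : List (CEdge n p q)) →
  nVerts S ≡ count (λ v → DecMembership._∈?_ Fin._≟_ v (endpoints S)) (allFin n)
nVerts≡count {n} S = card≡count Fin._≟_ (allFin n) (Unique.allFin⁺ n) ∈-allFin (endpoints S)

nVerts≤n : ∀ {n p q} (S : List (CEdge n p q)) → nVerts S ≤ n
nVerts≤n {n} S = subst (nVerts S ≤_) (List.length-tabulate {n = n} (λ i → i))
  (Cardinality.card≤length Fin._≟_ {xs = endpoints S} (λ {v} _ → ∈-allFin v))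

module Tight {n p q : ℕ} (E : List (CEdge n p q)) (sparse : ConeLamanSparse p q E) (edges : length E + 1 ≡ 2 * n) where

  open Representatives E

  private
    count-bound : ∀ {L0 L1} → Components p q E L0 L1 → length E + 3 * length L0 + length L1 ≤ length E + 1
    count-bound {L0} {L1} C =
      ≤-trans (sparse E ⊆-refl L0 L1 C) (≤-trans (*-monoʳ-≤ 2 (nVerts≤n E)) (≤-reflexive (sym edges)))

    E-nonempty : 1 ≤ length E
    E-nonempty = nonzero (length E) n edges
      where
      nonzero : ∀ m n → m + 1 ≡ 2 * n → 1 ≤ m
      nonzero (suc m) _ _ = s≤s z≤n
      nonzero zero (suc n) eq with subst (2 ≤_) (sym eq) (*-monoʳ-≤ 2 (s≤s (z≤n {n})))
      ... | s≤s ()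

  rank-one : ∀ {r} → r ∈ representatives → ¬ RankZero p q E r
  rank-one {r} m rank-zero = ¬¬-decide λ rank-zero? →
    let open Classified rank-zero? in
    too-many (count-bound components) (∈-filter⁺ rank-zero? m rank-zero)
    where
    too-many : ∀ {a L0 l₁} → a + 3 * length L0 + l₁ ≤ a + 1 → r ∈ L0 → ⊥
    too-many {a} {L0@(_ ∷ L0′)} {l₁} bound _ with +-cancelˡ-≤ a 3 1 (begin
      a + 3 * 1              ≤⟨ +-monoʳ-≤ a (*-monoʳ-≤ 3 (s≤s (z≤n {length L0′}))) ⟩
      a + 3 * length L0      ≤⟨ m≤m+n (a + 3 * length L0) l₁ ⟩
      a + 3 * length L0 + l₁ ≤⟨ bound ⟩
      a + 1                  ∎)
      where open ≤-Reasoning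
    ... | s≤s ()

  tight : ∃₂ λ L0 L1 → Components p q E L0 L1 × length E + 3 * length L0 + length L1 ≡ 2 * nVerts E
  tight = [] , representatives , C , ≤-antisym (sparse E ⊆-refl [] representatives C) (begin
      2 * nVerts E                      ≤⟨ *-monoʳ-≤ 2 (nVerts≤n E) ⟩
      2 * n                             ≡⟨ sym edges ⟩
      length E + 1                      ≤⟨ +-monoʳ-≤ (length E) representatives-nonempty ⟩
      length E + length representatives ≡⟨ cong (_+ length representatives) (sym (+-identityʳ (length E))) ⟩
      length E + 0 + length representatives ∎)
    where
    open ≤-Reasoning
    C : Components p q E [] representatives
    C = let (in-S , unique , separated , covers) = representatives-transversal in
        in-S , unique , separated , covers , [] , All.tabulate rank-one
    representatives-nonempty : 1 ≤ length representatives
    representatives-nonempty =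
      let (e , e∈E) = length-pos⇒∈ {xs = E} E-nonempty
          (_ , r∈ , _) = find (proj₂ (proj₂ (proj₂ representatives-transversal)) (tl e) (tl∈endpoints e∈E))
      in ∈-length r∈

-- The symmetric lift

_≟Γ_ : ∀ {p q} → DecidableEquality (Γ p q)
_≟Γ_ = ≡-dec Fin._≟_ Fin._≟_

length-cartesianProduct : {A B : Set} (xs : List A) (ys : List B) →
  length (cartesianProduct xs ys) ≡ length xs * length ys
length-cartesianProduct [] ys = refl
length-cartesianProduct (x ∷ xs) ys = trans (List.length-++ (map (x ,_) ys))
  (cong₂ _+_ (List.length-map (x ,_) ys) (length-cartesianProduct xs ys))

module Lift (p q : ℕ) .{{_ : NonZero p}} .{{_ : NonZero q}} {n : ℕ} where

  LEdge : Set
  LEdge = LiftV n p q × LiftV n p q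

  liftEdge : CEdge n p q → Γ p q → LEdge
  liftEdge e δ = ((tl e , δ) , (hd e , δ ⊕[ p , q ] col e))

  copies : CEdge n p q → List LEdge
  copies e = map (liftEdge e) (allΓ p q)

  liftVertices : List LEdge → List (LiftV n p q)
  liftVertices X = map proj₁ X ++ map proj₂ X

  ∈-allΓ : ∀ δ → δ ∈ allΓ p q
  ∈-allΓ (a , b) = ∈-cartesianProduct⁺ (∈-allFin a) (∈-allFin b)

  allΓ-unique : Unique (allΓ p q)
  allΓ-unique = Unique.cartesianProduct⁺ (Unique.allFin⁺ p) (Unique.allFin⁺ q)

  length-allΓ : length (allΓ p q) ≡ p * q
  length-allΓ = trans (length-cartesianProduct (allFin p) (allFin q))
    (cong₂ _*_ (List.length-tabulate {n = p} (λ i → i)) (List.length-tabulate {n = q} (λ i → i)))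

  length-lift : ∀ E → length (lift p q E) ≡ length E * (p * q)
  length-lift [] = refl
  length-lift (e ∷ E) = trans (List.length-++ (copies e))
    (cong₂ _+_ (trans (List.length-map (liftEdge e) (allΓ p q)) length-allΓ) (length-lift E))

  lift-mono : ∀ {S E} → S ⊆ E → lift p q S ⊆ lift p q E
  lift-mono [] = []
  lift-mono (e ∷ʳ S⊆E) = ++⁺ˡ (copies e) (lift-mono S⊆E)
  lift-mono (refl ∷ S⊆E) = ++⁺ ⊆-refl (lift-mono S⊆E)

  section-⊆-lift : ∀ {S E} → S ⊆ E → (f : CEdge n p q → Γ p q) → map (λ e → liftEdge e (f e)) S ⊆ lift p q E
  section-⊆-lift [] f = []
  section-⊆-lift (e ∷ʳ S⊆E) f = ++⁺ˡ (copies e) (section-⊆-lift S⊆E f)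
  section-⊆-lift {e ∷ S} (refl ∷ S⊆E) f = pick (∈-map⁺ (liftEdge e) (∈-allΓ (f e))) (section-⊆-lift S⊆E f)
    where
    pick : ∀ {x : LEdge} {xs ys zs} → x ∈ ys → xs ⊆ zs → x ∷ xs ⊆ ys ++ zs
    pick {ys = y ∷ ys} (here refl) xs⊆zs = refl ∷ ++⁺ˡ ys xs⊆zs
    pick {ys = y ∷ ys} (there x∈ys) xs⊆zs = y ∷ʳ pick x∈ys xs⊆zs

  ∈-lift⁻ : ∀ {S x} → x ∈ lift p q S → Σ (CEdge n p q) λ e → Σ (Γ p q) λ δ → e ∈ S × x ≡ liftEdge e δ
  ∈-lift⁻ {e ∷ S} m with ∈-++⁻ (copies e) m
  ... | inj₁ m′ = let (δ , _ , x≡) = ∈-map⁻ (liftEdge e) m′ in e , δ , here refl , x≡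
  ... | inj₂ m′ = let (e′ , δ , e′∈S , x≡) = ∈-lift⁻ {S} m′ in e′ , δ , there e′∈S , x≡

  liftVertices-lift : ∀ {S x} → x ∈ liftVertices (lift p q S) → proj₁ x ∈ endpoints S
  liftVertices-lift {S} m with ∈-++⁻ (map proj₁ (lift p q S)) m
  ... | inj₁ m₁ with ∈-map⁻ proj₁ m₁
  ...   | _ , y∈ , refl with ∈-lift⁻ {S} y∈
  ...     | _ , _ , e∈S , refl = tl∈endpoints e∈S
  liftVertices-lift {S} m | inj₂ m₂ with ∈-map⁻ proj₂ m₂
  ...   | _ , y∈ , refl with ∈-lift⁻ {S} y∈
  ...     | _ , _ , e∈S , refl = hd∈endpoints e∈S

-- A Laman-sparse lift makes the graph cone-Laman

module ComponentDecomposition {n p q : ℕ} {S : List (CEdge n p q)} {R : List (Fin n)} (T : Transversal S R) where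

  private
    open DecMembership (Fin._≟_ {n}) using (_∈?_)
    unique-R : Unique R
    unique-R = proj₁ (proj₂ T)

    separated : ∀ r r′ → r ∈ R → r′ ∈ R → r ≢ r′ → ¬ Walk S r r′
    separated = proj₁ (proj₂ (proj₂ T))

    covers : ∀ v → v ∈ endpoints S → Any (Walk S v) R
    covers = proj₂ (proj₂ (proj₂ T))

  componentEdges : Fin n → List (CEdge n p q)
  componentEdges r = filter (λ e → walk? S (tl e) r) S

  componentEdges-⊆ : ∀ r → componentEdges r ⊆ S
  componentEdges-⊆ r = filter-⊆ (λ e → walk? S (tl e) r) S

  ∈-componentEdges⁻ : ∀ {r e} → e ∈ componentEdges r → e ∈ S × Walk S (tl e) r
  ∈-componentEdges⁻ {r} = ∈-filter⁻ (λ e → walk? S (tl e) r) {xs = S}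

  walk-to-component : ∀ {r v} → v ∈ endpoints (componentEdges r) → Walk S v r
  walk-to-component {r} m with ∈-endpoints⁻ m
  ... | e , e∈ , inj₁ refl = proj₂ (∈-componentEdges⁻ e∈)
  ... | e , e∈ , inj₂ refl = let (e∈S , w) = ∈-componentEdges⁻ e∈ in bwd e e∈S w

  ∈-endpoints-component : ∀ {r v} → v ∈ endpoints S → Walk S v r → v ∈ endpoints (componentEdges r)
  ∈-endpoints-component {r} m w with ∈-endpoints⁻ m
  ... | e , e∈S , inj₁ refl = tl∈endpoints (∈-filter⁺ (λ e → walk? S (tl e) r) e∈S w)
  ... | e , e∈S , inj₂ refl = hd∈endpoints (∈-filter⁺ (λ e → walk? S (tl e) r) e∈S (fwd e e∈S w))

  same-component : ∀ {v r r′} → r ∈ R → r′ ∈ R → Walk S v r → Walk S v r′ → r ≡ r′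
  same-component {r = r} {r′} m m′ w w′ with r Fin.≟ r′
  ... | yes r≡r′ = r≡r′
  ... | no r≢r′ = ⊥-elim (separated r r′ m m′ r≢r′ (reverseʷ w ++ʷ w′))

  componentEdges-nonempty : ∀ {r} → r ∈ R → 1 ≤ length (componentEdges r)
  componentEdges-nonempty {r} m =
    let (_ , e∈ , _) = ∈-endpoints⁻ {S = componentEdges r} (∈-endpoints-component (All.lookup (proj₁ T) m) stop)
    in ∈-length e∈

  edges-partition : length S ≡ ∑[ r ∈ R ] length (componentEdges r)
  edges-partition = sym (begin
    ∑[ r ∈ R ] length (componentEdges r)
      ≡⟨ ∑-cong R (λ r _ → length-filter≡count (λ e → walk? S (tl e) r) S) ⟩
    ∑[ r ∈ R ] count (λ e → walk? S (tl e) r) S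
      ≡⟨ ∑-count-partition (λ _ → yes tt) (λ r e → walk? S (tl e) r) R unique-R S
           (λ e e∈S _ → find (covers (tl e) (tl∈endpoints e∈S)))
           (λ e _ r r′ m m′ → same-component m m′)
           (λ e _ ¬⊤ → ⊥-elim (¬⊤ tt)) ⟩
    count (λ _ → yes tt) S
      ≡⟨ sym (length-filter≡count (λ _ → yes tt) S) ⟩
    length (filter (λ _ → yes tt) S)
      ≡⟨ cong length (List.filter-all (λ _ → yes tt) (All.universal (λ _ → tt) S)) ⟩
    length S ∎)
    where open ≡-Reasoning

  vertices-partition : nVerts S ≡ ∑[ r ∈ R ] nVerts (componentEdges r)
  vertices-partition = sym (begin
    ∑[ r ∈ R ] nVerts (componentEdges r)
      ≡⟨ ∑-cong R (λ r _ → nVerts≡count (componentEdges r)) ⟩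
    ∑[ r ∈ R ] count (_∈? endpoints (componentEdges r)) (allFin n)
      ≡⟨ ∑-count-partition (_∈? endpoints S) (λ r → _∈? endpoints (componentEdges r)) R unique-R (allFin n)
           (λ v _ v∈S → let (r , r∈R , w) = find (covers v v∈S) in r , r∈R , ∈-endpoints-component v∈S w)
           (λ v _ r r′ m m′ v∈ v∈′ → same-component m m′ (walk-to-component v∈) (walk-to-component v∈′))
           (λ v _ v∉S r _ v∈ → v∉S (endpoints-mono (lookup (componentEdges-⊆ r)) v∈)) ⟩
    count (_∈? endpoints S) (allFin n)
      ≡⟨ sym (nVerts≡count S) ⟩
    nVerts S ∎)
    where open ≡-Reasoning

IsPotential : ∀ {n p q} .{{_ : NonZero p}} .{{_ : NonZero q}} → (Fin n → Γ p q) → List (CEdge n p q) → Set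
IsPotential {p = p} {q} π S = ∀ {e} → e ∈ S → π (hd e) ≡ π (tl e) ⊕[ p , q ] col e

module Potential (p q : ℕ) .{{_ : NonZero p}} .{{_ : NonZero q}} {n : ℕ} {S : List (CEdge n p q)}
  (r : Fin n) (rank-zero : RankZero p q S r) where

  open Congruence² p q
  open import Relation.Binary.Reasoning.Setoid ≈²-setoid hiding (stop)

  private
    valueAt : ∀ {v} → Dec (Walk S r v) → Γ p q
    valueAt (yes w) = reduce² (ρℤ w)
    -- vertices outside the component of r get an arbitrary value
    valueAt (no _) = reduce² 0²

    closed-walk : ∀ {e} (e∈S : e ∈ S) (wt : Walk S r (tl e)) (wh : Walk S r (hd e)) →
      ρℤ (wt ++ʷ fwd e e∈S (reverseʷ wh)) ≡ ρℤ wt +² (ι (col e) +² -² ρℤ wh)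
    closed-walk {e} e∈S wt wh = trans (ρ-++ wt _) (cong (ρℤ wt +²_)
      (trans (ρ-fwd e e∈S (reverseʷ wh)) (cong (ι (col e) +²_) (ρ-reverse wh))))

    cancel : ∀ a b c → a +² (b +² (c +² -² a)) ≡ b +² c
    cancel a b c = cong₂ _,_ (cancelℤ (proj₁ a) (proj₁ b) (proj₁ c)) (cancelℤ (proj₂ a) (proj₂ b) (proj₂ c))
      where
      cancelℤ : ∀ a b c → a +ℤ (b +ℤ (c +ℤ - a)) ≡ b +ℤ c
      cancelℤ = solve-∀

  potential : Fin n → Γ p q
  potential v = valueAt (walk? S r v)

  potential-consistent : ∀ {e} → e ∈ S → Walk S (tl e) r → potential (hd e) ≡ potential (tl e) ⊕[ p , q ] col e
  potential-consistent {e} e∈S to-r = consistent (walk? S r (tl e)) (walk? S r (hd e))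
    where
    consistent : ∀ dt dh → valueAt dh ≡ valueAt dt ⊕[ p , q ] col e
    consistent (no ¬wt) _ = ⊥-elim (¬wt (reverseʷ to-r))
    consistent (yes _) (no ¬wh) = ⊥-elim (¬wh (reverseʷ to-r ++ʷ fwd e e∈S stop))
    consistent (yes wt) (yes wh) = ι-injective (begin
      ι (reduce² (ρℤ wh))                          ≈⟨ ι-reduce² (ρℤ wh) ⟩
      ρℤ wh                                        ≡⟨ sym (+²-identityʳ (ρℤ wh)) ⟩
      ρℤ wh +² 0²                                  ≈⟨ +²-congˡ (ρℤ wh) (≈²-sym closed≈0) ⟩
      ρℤ wh +² ρℤ c                                ≡⟨ cong (ρℤ wh +²_) (closed-walk e∈S wt wh) ⟩
      ρℤ wh +² (ρℤ wt +² (ι (col e) +² -² ρℤ wh))  ≡⟨ cancel (ρℤ wh) (ρℤ wt) (ι (col e)) ⟩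
      ρℤ wt +² ι (col e)                           ≈⟨ +²-congʳ (ι (col e)) (≈²-sym (ι-reduce² (ρℤ wt))) ⟩
      ι (reduce² (ρℤ wt)) +² ι (col e)             ≈⟨ ≈²-sym (ι-⊕ (reduce² (ρℤ wt)) (col e)) ⟩
      ι (reduce² (ρℤ wt) ⊕[ p , q ] col e)         ∎)
      where
      c : Walk S r r
      c = wt ++ʷ fwd e e∈S (reverseʷ wh)
      closed≈0 : ρℤ c ≈² 0²
      closed≈0 = Divisible²⇒≈²0 (rank-zero r stop c)

module FromLift (p q : ℕ) .{{_ : NonZero p}} .{{_ : NonZero q}} {n : ℕ} (E : List (CEdge n p q))
  (lift-sparse : LamanSparse _≟L_ (lift p q E)) where

  open Lift p q {n}
  open Cardinality (_≟L_ {n} {p} {q}) using (card-cong; card≤length)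

  private
    N : ℕ
    N = p * q

  full-lift-bound : ∀ {S} → S ⊆ E → 1 ≤ length S → length S + 1 ≤ 2 * nVerts S
  full-lift-bound {S} S⊆E nonempty =
    subst (_≤ 2 * nVerts S) (+-comm 1 (length S)) (*-cancelʳ-< N (length S) (2 * nVerts S) (begin-strict
      length S * N                               <⟨ m<m+n (length S * N) {3} (s≤s z≤n) ⟩
      length S * N + 3                           ≡⟨ cong (_+ 3) (sym (length-lift S)) ⟩
      length (lift p q S) + 3                    ≤⟨ lift-sparse (lift p q S) (lift-mono S⊆E) lift-nonempty ⟩
      2 * card _≟L_ (liftVertices (lift p q S))   ≤⟨ *-monoʳ-≤ 2 lift-vertices ⟩
      2 * (nVerts S * N)                         ≡⟨ sym (*-assoc 2 (nVerts S) N) ⟩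
      2 * nVerts S * N                           ∎))
    where
    open ≤-Reasoning
    lift-nonempty : 1 ≤ length (lift p q S)
    lift-nonempty = subst (1 ≤_) (sym (length-lift S)) (*-mono-≤ nonempty (>-nonZero⁻¹ N {{m*n≢0 p q}}))
    lift-vertices : card _≟L_ (liftVertices (lift p q S)) ≤ nVerts S * N
    lift-vertices = subst (card _≟L_ (liftVertices (lift p q S)) ≤_)
      (trans (length-cartesianProduct (deduplicate Fin._≟_ (endpoints S)) (allΓ p q)) (cong (nVerts S *_) length-allΓ))
      (card≤length λ {x} m →
        ∈-cartesianProduct⁺ (∈-deduplicate⁺ Fin._≟_ (liftVertices-lift {S} m)) (∈-allΓ (proj₂ x)))

  section-bound : ∀ {S} → S ⊆ E → (π : Fin n → Γ p q) → IsPotential π S →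
    1 ≤ length S → length S + 3 ≤ 2 * nVerts S
  section-bound {S} S⊆E π consistent nonempty =
    subst₂ (λ a b → a + 3 ≤ 2 * b) (List.length-map section S)
      (trans (card-cong graph-⊆ ⊆-graph) (card-map-injective Fin._≟_ _≟L_ g g-injective (endpoints S)))
      (lift-sparse X (section-⊆-lift S⊆E (λ e → π (tl e))) (subst (1 ≤_) (sym (List.length-map section S)) nonempty))
    where
    section : CEdge n p q → LEdge
    section e = liftEdge e (π (tl e))
    X : List LEdge
    X = map section S
    g : Fin n → LiftV n p q
    g v = (v , π v)
    g-injective : ∀ {u v} → g u ≡ g v → u ≡ v
    g-injective refl = refl

    graph-⊆ : liftVertices X ⊆ˢ map g (endpoints S)
    graph-⊆ m with ∈-++⁻ (map proj₁ X) m
    ... | inj₁ m₁ with ∈-map⁻ proj₁ m₁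
    ...   | _ , m′ , refl with ∈-map⁻ section m′
    ...     | e , e∈S , refl = ∈-map⁺ g (tl∈endpoints e∈S)
    graph-⊆ m | inj₂ m₂ with ∈-map⁻ proj₂ m₂
    ...   | _ , m′ , refl with ∈-map⁻ section m′
    ...     | e , e∈S , refl =
      subst (λ δ → (hd e , δ) ∈ map g (endpoints S)) (consistent e∈S) (∈-map⁺ g (hd∈endpoints e∈S))

    ⊆-graph : map g (endpoints S) ⊆ˢ liftVertices X
    ⊆-graph m with ∈-map⁻ g m
    ... | v , v∈S , refl with ∈-endpoints⁻ v∈S
    ...   | e , e∈S , inj₁ refl = ∈-++⁺ˡ (∈-map⁺ proj₁ (∈-map⁺ section e∈S))
    ...   | e , e∈S , inj₂ refl = subst (λ δ → (hd e , δ) ∈ liftVertices X) (sym (consistent e∈S))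
                                   (∈-++⁺ʳ (map proj₁ X) (∈-map⁺ proj₂ (∈-map⁺ section e∈S)))

  coneLamanSparse : ConeLamanSparse p q E
  coneLamanSparse S S⊆E L0 L1 (in-S , unique , separated , covers , rank0 , rank1) = begin
    length S + 3 * length L0 + length L1
      ≡⟨ cong (λ m → m + 3 * length L0 + length L1) (trans edges-partition (∑-++ L0 L1 edges)) ⟩
    ∑ L0 edges + ∑ L1 edges + 3 * length L0 + length L1
      ≡⟨ regroup (∑ L0 edges) (∑ L1 edges) (length L0) (length L1) ⟩
    (∑ L0 edges + length L0 * 3) + (∑ L1 edges + length L1 * 1)
      ≤⟨ +-mono-≤ (∑-mono-+ L0 3 rank0-bound) (∑-mono-+ L1 1 rank1-bound) ⟩
    ∑[ r ∈ L0 ] (2 * vertices r) + ∑[ r ∈ L1 ] (2 * vertices r)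
      ≡⟨ cong₂ _+_ (∑-*ˡ L0 2 vertices) (∑-*ˡ L1 2 vertices) ⟩
    2 * ∑ L0 vertices + 2 * ∑ L1 vertices
      ≡⟨ sym (*-distribˡ-+ 2 (∑ L0 vertices) (∑ L1 vertices)) ⟩
    2 * (∑ L0 vertices + ∑ L1 vertices)
      ≡⟨ cong (2 *_) (sym (trans vertices-partition (∑-++ L0 L1 vertices))) ⟩
    2 * nVerts S ∎
    where
    open ≤-Reasoning
    open ComponentDecomposition (in-S , unique , separated , covers)
    edges vertices : Fin n → ℕ
    edges r = length (componentEdges r)
    vertices r = nVerts (componentEdges r)

    regroup : ∀ e₀ e₁ l₀ l₁ → e₀ + e₁ + 3 * l₀ + l₁ ≡ (e₀ + l₀ * 3) + (e₁ + l₁ * 1)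
    regroup = ℕ-Solver.solve-∀

    rank0-bound : ∀ r → r ∈ L0 → edges r + 3 ≤ 2 * vertices r
    rank0-bound r m = section-bound (⊆-trans (componentEdges-⊆ r) S⊆E) potential
      (λ e∈ → let (e∈S , w) = ∈-componentEdges⁻ e∈ in potential-consistent e∈S w)
      (componentEdges-nonempty (∈-++⁺ˡ m))
      where open Potential p q r (All.lookup rank0 m)

    rank1-bound : ∀ r → r ∈ L1 → edges r + 1 ≤ 2 * vertices r
    rank1-bound r m = full-lift-bound (⊆-trans (componentEdges-⊆ r) S⊆E) (componentEdges-nonempty (∈-++⁺ʳ L0 m))

-- A cone-Laman-sparse graph has a Laman-sparse lift

module Layers (p q : ℕ) .{{_ : NonZero p}} .{{_ : NonZero q}} {n : ℕ} where
  open Lift p q {n}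

  data Split : List (CEdge n p q) → List LEdge → Set where
    []  : Split [] []
    _∷_ : ∀ {e E Ds X} → Ds ⊆ allΓ p q → Split E X → Split (e ∷ E) (map (liftEdge e) Ds ++ X)

  split : ∀ E {X} → X ⊆ lift p q E → Split E X
  split [] [] = []
  split (e ∷ E) X⊆ with ⊆-++⁻ (copies e) X⊆
  ... | X₁ , X₂ , refl , X₁⊆ , X₂⊆ with ⊆-map⁻ (liftEdge e) X₁⊆
  ...   | Ds , Ds⊆ , refl = Ds⊆ ∷ split E X₂⊆

  layer : ∀ {E X} → ℕ → Split E X → List (CEdge n p q)
  layer t [] = []
  layer t (_∷_ {e} {Ds = Ds} _ s) with t ≤? length Ds
  ... | yes _ = e ∷ layer t s
  ... | no _ = layer t s

  layer-⊆ : ∀ {E X} t (s : Split E X) → layer t s ⊆ E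
  layer-⊆ t [] = []
  layer-⊆ t (_∷_ {e} {Ds = Ds} _ s) with t ≤? length Ds
  ... | yes _ = refl ∷ layer-⊆ t s
  ... | no _ = e ∷ʳ layer-⊆ t s

  length-layer-∷ : ∀ {e E Ds X} t (Ds⊆ : Ds ⊆ allΓ p q) (s : Split E X) →
    length (layer t (_∷_ {e} Ds⊆ s)) ≡ indicator (t ≤? length Ds) + length (layer t s)
  length-layer-∷ {Ds = Ds} t _ s with t ≤? length Ds
  ... | yes _ = refl
  ... | no _ = refl

  ∑-length-layer : ∀ {E X} (s : Split E X) → ∑[ t ∈ [1‥ p * q ] ] length (layer t s) ≡ length X
  ∑-length-layer [] = ∑-zero [1‥ p * q ] (λ _ → refl)
  ∑-length-layer (_∷_ {e} {Ds = Ds} {X} Ds⊆ s) = begin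
    ∑[ t ∈ [1‥ p * q ] ] length (layer t (Ds⊆ ∷ s))
      ≡⟨ ∑-cong [1‥ p * q ] (λ t _ → length-layer-∷ t Ds⊆ s) ⟩
    ∑[ t ∈ [1‥ p * q ] ] (indicator (t ≤? length Ds) + length (layer t s))
      ≡⟨ ∑-distrib-+ [1‥ p * q ] _ _ ⟩
    count (_≤? length Ds) [1‥ p * q ] + ∑[ t ∈ [1‥ p * q ] ] length (layer t s)
      ≡⟨ cong₂ _+_ (count-[1‥] Ds≤N) (∑-length-layer s) ⟩
    length Ds + length X
      ≡⟨ cong (_+ length X) (sym (List.length-map (liftEdge e) Ds)) ⟩
    length (map (liftEdge e) Ds) + length X
      ≡⟨ sym (List.length-++ (map (liftEdge e) Ds)) ⟩
    length (map (liftEdge e) Ds ++ X) ∎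
    where
    open ≡-Reasoning
    Ds≤N : length Ds ≤ p * q
    Ds≤N = subst (length Ds ≤_) length-allΓ (length-mono-≤ Ds⊆)

  record LayerEdge {X} (t : ℕ) (e : CEdge n p q) : Set where
    field
      shifts : List (Γ p q)
      unique : Unique shifts
      many : t ≤ length shifts
      lifted : ∀ {δ} → δ ∈ shifts → liftEdge e δ ∈ X

  LayerEdge-weaken : ∀ {X Y t e} → (∀ {x} → x ∈ X → x ∈ Y) → LayerEdge {X} t e → LayerEdge {Y} t e
  LayerEdge-weaken X⊆Y E = record { LayerEdge E ; lifted = λ m → X⊆Y (LayerEdge.lifted E m) }

  layer-edge : ∀ {E X} t (s : Split E X) {e} → e ∈ layer t s → LayerEdge {X} t e
  layer-edge t (_∷_ {Ds = Ds} Ds⊆ s) e∈ with t ≤? length Ds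
  ... | no _ = LayerEdge-weaken (∈-++⁺ʳ _) (layer-edge t s e∈)
  ... | yes t≤ with e∈
  ...   | there e∈′ = LayerEdge-weaken (∈-++⁺ʳ _) (layer-edge t s e∈′)
  ...   | here refl = record
    { shifts = Ds ; unique = Unique-resp-⊇ Ds⊆ allΓ-unique ; many = t≤ ; lifted = λ m → ∈-++⁺ˡ (∈-map⁺ _ m) }

  layer-1-nonempty : ∀ {E X} (s : Split E X) {x} → x ∈ X → Σ (CEdge n p q) (_∈ layer 1 s)
  layer-1-nonempty (_∷_ {e} {Ds = Ds} _ s) x∈ with 1 ≤? length Ds | ∈-++⁻ (map (liftEdge e) Ds) x∈
  ... | yes _ | _ = e , here refl
  ... | no _ | inj₂ x∈X = layer-1-nonempty s x∈X
  ... | no 1≰ | inj₁ x∈Ds = ⊥-elim (1≰ (∈-length (proj₁ (proj₂ (∈-map⁻ (liftEdge e) x∈Ds)))))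

module Fibres (p q : ℕ) .{{_ : NonZero p}} .{{_ : NonZero q}} {n : ℕ} {E : List (CEdge n p q)} {X} (s : Layers.Split p q E X) where

  open Lift p q {n}
  open Layers p q {n}
  open Congruence² p q
  open DecMembership (_≟L_ {n} {p} {q}) using (_∈?_)

  InFibre : Fin n → Γ p q → Set
  InFibre v δ = (v , δ) ∈ liftVertices X

  fibre : Fin n → ℕ
  fibre v = count (λ δ → (v , δ) ∈? liftVertices X) (allΓ p q)

  fibre≤N : ∀ v → fibre v ≤ p * q
  fibre≤N v = subst (fibre v ≤_) length-allΓ (count≤length (λ δ → (v , δ) ∈? liftVertices X) (allΓ p q))

  level : ℕ → ℕ
  level t = count (λ v → t ≤? fibre v) (allFin n)

  length≤fibre : ∀ {v us} → Unique us → (∀ {δ} → δ ∈ us → InFibre v δ) → length us ≤ fibre v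
  length≤fibre {v} {us} unique in-fibre =
    subst (length us ≤_) (length-filter≡count (λ δ → (v , δ) ∈? liftVertices X) (allΓ p q))
    (Unique⇒length≤ unique λ m → ∈-filter⁺ (λ δ → (v , δ) ∈? liftVertices X) (∈-allΓ _) (in-fibre m))

  private
    tail-in-fibre : ∀ {e δ} → liftEdge e δ ∈ X → InFibre (tl e) δ
    tail-in-fibre m = ∈-++⁺ˡ (∈-map⁺ proj₁ m)

    head-in-fibre : ∀ {e δ} → liftEdge e δ ∈ X → InFibre (hd e) (δ ⊕[ p , q ] col e)
    head-in-fibre m = ∈-++⁺ʳ (map proj₁ X) (∈-map⁺ proj₂ m)

    head-shifts : ∀ {t} e → LayerEdge {X} t e → List (Γ p q)
    head-shifts e E = map (_⊕[ p , q ] col e) (LayerEdge.shifts E)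

    head-shifts-unique : ∀ {t} e (E : LayerEdge {X} t e) → Unique (head-shifts e E)
    head-shifts-unique e E = Unique.map⁺ (⊕-cancelʳ (col e)) (LayerEdge.unique E)

    head-shifts-in-fibre : ∀ {t} e (E : LayerEdge {X} t e) → ∀ {δ} → δ ∈ head-shifts e E → InFibre (hd e) δ
    head-shifts-in-fibre e E m with ∈-map⁻ (_⊕[ p , q ] col e) m
    ... | _ , m′ , refl = head-in-fibre (LayerEdge.lifted E m′)

    length-head-shifts : ∀ {t} e (E : LayerEdge {X} t e) → t ≤ length (head-shifts e E)
    length-head-shifts e E = subst (_ ≤_) (sym (List.length-map _ (LayerEdge.shifts E))) (LayerEdge.many E)

  layer-endpoint-fibre : ∀ t {v} → v ∈ endpoints (layer t s) → t ≤ fibre v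
  layer-endpoint-fibre t m with ∈-endpoints⁻ m
  ... | e , e∈ , inj₁ refl = let E = layer-edge t s e∈ in
    ≤-trans (LayerEdge.many E) (length≤fibre (LayerEdge.unique E) (λ m → tail-in-fibre (LayerEdge.lifted E m)))
  ... | e , e∈ , inj₂ refl = let E = layer-edge t s e∈ in
    ≤-trans (length-head-shifts e E) (length≤fibre (head-shifts-unique e E) (head-shifts-in-fibre e E))

  card-liftVertices : card _≟L_ (liftVertices X) ≡ ∑[ t ∈ [1‥ p * q ] ] level t
  card-liftVertices = begin
    card _≟L_ (liftVertices X)
      ≡⟨ card≡count _≟L_ (cartesianProduct (allFin n) (allΓ p q))
           (Unique.cartesianProduct⁺ (Unique.allFin⁺ n) allΓ-unique)
           (λ (v , δ) → ∈-cartesianProduct⁺ (∈-allFin v) (∈-allΓ δ)) (liftVertices X) ⟩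
    count (_∈? liftVertices X) (cartesianProduct (allFin n) (allΓ p q))
      ≡⟨ count-cartesianProduct (_∈? liftVertices X) (allFin n) (allΓ p q) ⟩
    ∑[ v ∈ allFin n ] fibre v
      ≡⟨ ∑-cong (allFin n) (λ v _ → sym (count-[1‥] (fibre≤N v))) ⟩
    ∑[ v ∈ allFin n ] ∑[ t ∈ [1‥ p * q ] ] indicator (t ≤? fibre v)
      ≡⟨ ∑-comm (allFin n) [1‥ p * q ] (λ v t → indicator (t ≤? fibre v)) ⟩
    ∑[ t ∈ [1‥ p * q ] ] level t ∎
    where open ≡-Reasoning

  nVerts-layer≤level : ∀ t → nVerts (layer t s) ≤ level t
  nVerts-layer≤level t = subst (_≤ level t) (sym (nVerts≡count (layer t s)))
    (count-mono _ (λ v → t ≤? fibre v) (allFin n) (λ v _ → layer-endpoint-fibre t))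

  -- If no fibre has more than t points, pigeonhole puts a copy of each edge of layer t over every
  -- point of the fibre of its tail, so walks in layer t can be followed up through X.
  module TopLayer (t : ℕ) (fibre≤t : ∀ v → fibre v ≤ t) where

    private
      complete-tail : ∀ {e a} (E : LayerEdge {X} t e) → InFibre (tl e) a → a ∈ LayerEdge.shifts E
      complete-tail {e} E =
        pigeonhole _≟Γ_ (λ δ → (tl e , δ) ∈? liftVertices X) (allΓ p q) ∈-allΓ
          {vs = LayerEdge.shifts E} (LayerEdge.unique E)
          (λ m → tail-in-fibre (LayerEdge.lifted E m)) (≤-trans (fibre≤t (tl e)) (LayerEdge.many E))

      complete-head : ∀ {e b} (E : LayerEdge {X} t e) → InFibre (hd e) b → b ∈ head-shifts e E
      complete-head {e} E =
        pigeonhole _≟Γ_ (λ δ → (hd e , δ) ∈? liftVertices X) (allΓ p q) ∈-allΓ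
          {vs = head-shifts e E} (head-shifts-unique e E)
          (head-shifts-in-fibre e E) (≤-trans (fibre≤t (hd e)) (length-head-shifts e E))

    forward : ∀ {e a} → e ∈ layer t s → InFibre (tl e) a → InFibre (hd e) (a ⊕[ p , q ] col e)
    forward e∈ a∈ = let E = layer-edge t s e∈ in head-in-fibre (LayerEdge.lifted E (complete-tail E a∈))

    backward : ∀ {e b} → e ∈ layer t s → InFibre (hd e) b → Σ (Γ p q) λ a → InFibre (tl e) a × a ⊕[ p , q ] col e ≡ b
    backward {e} e∈ b∈ =
      let E = layer-edge t s e∈
          (a , a∈ , b≡) = ∈-map⁻ (_⊕[ p , q ] col e) (complete-head E b∈)
      in a , tail-in-fibre (LayerEdge.lifted E a∈) , sym b≡

    transport : ∀ {u v} (w : Walk (layer t s) u v) {a} → InFibre u a →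
      Σ (Γ p q) λ b → InFibre v b × ι b ≈² ι a +² ρℤ w
    transport stop {a} a∈ = a , a∈ , ≈²-reflexive (sym (+²-identityʳ (ι a)))
    transport (fwd e m w) {a} a∈ =
      let (b , b∈ , b≈) = transport w (forward m a∈)
      in b , b∈ , ≈²-trans b≈ (≈²-trans (⊕-shift a (col e) (ρℤ w))
           (≈²-reflexive (cong (ι a +²_) (sym (ρ-fwd e m w)))))
    transport (bwd e m w) {b} b∈ =
      let (a , a∈ , a⊕c≡b) = backward m b∈
          (c , c∈ , c≈) = transport w a∈
      in c , c∈ , ≈²-trans c≈ (≈²-trans (⊕-unshift a (col e) (ρℤ w))
           (≈²-reflexive (cong₂ _+²_ (cong ι a⊕c≡b) (sym (ρ-bwd e m w)))))

    module _ (p-prime : Prime p) (q-prime : Prime q) (p≢2 : p ≢ 2) (q≢2 : q ≢ 2) (t≤2 : t ≤ 2) (1≤t : 1 ≤ t) where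

      private
        fibre-nonempty : ∀ {v} → v ∈ endpoints (layer t s) → Σ (Γ p q) λ a → a ∈ allΓ p q × InFibre v a
        fibre-nonempty {v} v∈ =
          count-pos⁻ (λ δ → (v , δ) ∈? liftVertices X) (allΓ p q) (≤-trans 1≤t (layer-endpoint-fibre t v∈))

        -- Following c twice from a gives a, a₁, a₂ in a fibre with at most two points.
        orbit-zero : ∀ {u a a₁ a₂} r → InFibre u a → InFibre u a₁ → InFibre u a₂ →
          ι a₁ ≈² ι a +² r → ι a₂ ≈² ι a₁ +² r → r ≈² 0²
        orbit-zero {u} {a} {a₁} {a₂} r a∈ a₁∈ a₂∈ a₁≈ a₂≈ with a ≟Γ a₁ | a₁ ≟Γ a₂ | a ≟Γ a₂
        ... | yes refl | _ | _ = +²-cancelˡ a₁≈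
        ... | no _ | yes refl | _ = +²-cancelˡ a₂≈
        ... | no _ | no _ | yes refl = double≈²0⇒≈²0 p-prime q-prime p≢2 q≢2 r
          (+²-cancelˡ (≈²-trans a₂≈ (≈²-trans (+²-congʳ r a₁≈) (≈²-reflexive (+²-assoc (ι a) r r)))))
        ... | no a≢a₁ | no a₁≢a₂ | no a≢a₂ = ⊥-elim (<-irrefl refl (≤-trans three≤ (≤-trans (fibre≤t u) t≤2)))
          where
          three≤ : 3 ≤ fibre u
          three≤ = length≤fibre ((a≢a₁ ∷ a≢a₂ ∷ []) ∷ (a₁≢a₂ ∷ []) ∷ [] ∷ [])
            λ { (here refl) → a∈ ; (there (here refl)) → a₁∈ ; (there (there (here refl))) → a₂∈ }

        closed-from : ∀ {u} (c : Walk (layer t s) u u) {a} → InFibre u a → ρℤ c ≈² 0²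
        closed-from c a∈ =
          let (a₁ , a₁∈ , a₁≈) = transport c a∈
              (a₂ , a₂∈ , a₂≈) = transport c a₁∈
          in orbit-zero (ρℤ c) a∈ a₁∈ a₂∈ a₁≈ a₂≈

      top-layer-rank-zero : ∀ r → RankZero p q (layer t s) r
      top-layer-rank-zero r u w stop = ≈²0⇒Divisible² (≈²-reflexive refl)
      top-layer-rank-zero r u w c@(fwd e m _) =
        ≈²0⇒Divisible² (closed-from c (proj₂ (proj₂ (fibre-nonempty (tl∈endpoints m)))))
      top-layer-rank-zero r u w c@(bwd e m _) =
        ≈²0⇒Divisible² (closed-from c (proj₂ (proj₂ (fibre-nonempty (hd∈endpoints m)))))

∑-[1‥]-surplus : ∀ {N} → 3 ≤ N → (g h : ℕ → ℕ) → (∀ t → g t ≤ h t) → ∀ {d₁ d₂ d₃} →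
  g 1 + d₁ ≤ h 1 → g 2 + d₂ ≤ h 2 → g 3 + d₃ ≤ h 3 → ∑ [1‥ N ] g + (d₁ + d₂ + d₃) ≤ ∑ [1‥ N ] h
∑-[1‥]-surplus {suc (suc (suc K))} (s≤s (s≤s (s≤s z≤n))) g h g≤h {d₁} {d₂} {d₃} b₁ b₂ b₃ =
  subst (_≤ ∑ [1‥ 3 + K ] h) (regroup (g 1) (g 2) (g 3) (∑ rest g) d₁ d₂ d₃)
    (+-mono-≤ b₁ (+-mono-≤ b₂ (+-mono-≤ b₃ (∑-mono rest (λ t _ → g≤h t)))))
  where
  rest : List ℕ
  rest = map suc (map suc (map suc [1‥ K ]))
  regroup : ∀ a b c r x y z → (a + x) + ((b + y) + ((c + z) + r)) ≡ (a + (b + (c + r))) + (x + y + z)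
  regroup = ℕ-Solver.solve-∀

module ToLift (p q : ℕ) .{{_ : NonZero p}} .{{_ : NonZero q}} {n : ℕ} (E : List (CEdge n p q))
  (sparse : ConeLamanSparse p q E) {X} (X⊆ : X ⊆ lift p q E) where

  open Lift p q {n}
  open Layers p q {n}

  private
    s : Split E X
    s = split E X⊆

  open Fibres p q s

  layer-bound : ∀ t c → (∀ {L0 L1} → Components p q (layer t s) L0 L1 → c ≤ 3 * length L0 + length L1) →
    length (layer t s) + c ≤ 2 * level t
  layer-bound t c enough = decidable-stable (length (layer t s) + c ≤? 2 * level t) do
    (L0 , L1 , C) ← components-exist p q (layer t s)
    pure (begin
      length (layer t s) + c                            ≤⟨ +-monoʳ-≤ (length (layer t s)) (enough C) ⟩
      length (layer t s) + (3 * length L0 + length L1)  ≡⟨ sym (+-assoc (length (layer t s)) _ _) ⟩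
      length (layer t s) + 3 * length L0 + length L1    ≤⟨ sparse (layer t s) (layer-⊆ t s) L0 L1 C ⟩
      2 * nVerts (layer t s)                            ≤⟨ *-monoʳ-≤ 2 (nVerts-layer≤level t) ⟩
      2 * level t                                       ∎)
    where open ≤-Reasoning

  layer-bound₀ : ∀ t → length (layer t s) ≤ 2 * level t
  layer-bound₀ t = subst (_≤ 2 * level t) (+-identityʳ _) (layer-bound t 0 (λ _ → z≤n))

  layer-bound₁ : ∀ t → 1 ≤ level t → length (layer t s) + 1 ≤ 2 * level t
  layer-bound₁ t 1≤level with layer t s | layer-bound t 1
  ... | [] | _ = ≤-trans 1≤level (m≤m+n (level t) _)
  ... | e ∷ _ | bound = bound (λ C → components-pos C (here refl))

  layer-bound₃ : ∀ t → (∀ r → RankZero p q (layer t s) r) → ∀ {e} → e ∈ layer t s →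
    length (layer t s) + 3 ≤ 2 * level t
  layer-bound₃ t rank-zero e∈ = layer-bound t 3 (λ C → rank-zero-components C e∈ rank-zero)

  module _ (p-prime : Prime p) (q-prime : Prime q) (p≢2 : p ≢ 2) (q≢2 : q ≢ 2) (X-nonempty : 1 ≤ length X) where

    private
      N : ℕ
      N = p * q

      3≤N : 3 ≤ N
      3≤N = ≤-trans (odd-prime p-prime p≢2) (m≤m*n p q {{prime⇒nonZero q-prime}})
        where
        odd-prime : ∀ {m} → Prime m → m ≢ 2 → 3 ≤ m
        odd-prime {m} m-prime m≢2 with nonTrivial⇒n>1 m {{prime⇒nonTrivial m-prime}}
        ... | s≤s (s≤s z≤n) with m
        ...   | suc (suc zero) = ⊥-elim (m≢2 refl)
        ...   | suc (suc (suc _)) = s≤s (s≤s (s≤s z≤n))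

      level-pos : ∀ t {v} → t ≤ fibre v → 1 ≤ level t
      level-pos t {v} t≤ = count-pos (λ v → t ≤? fibre v) (∈-allFin v) t≤

      fibres≤ : ∀ t → ¬ ∃ (λ v → suc t ≤ fibre v) → ∀ v → fibre v ≤ t
      fibres≤ t none v with fibre v ≤? t
      ... | yes ≤t = ≤t
      ... | no ≰t = ⊥-elim (none (v , ≰⇒> ≰t))

      bonus : ∀ d₁ d₂ d₃ → d₁ + d₂ + d₃ ≡ 3 →
        length (layer 1 s) + d₁ ≤ 2 * level 1 → length (layer 2 s) + d₂ ≤ 2 * level 2 →
        length (layer 3 s) + d₃ ≤ 2 * level 3 →
        length X + 3 ≤ 2 * card _≟L_ (liftVertices X)
      bonus d₁ d₂ d₃ d≡3 b₁ b₂ b₃ = begin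
        length X + 3                                          ≡⟨ cong₂ _+_ (sym (∑-length-layer s)) (sym d≡3) ⟩
        ∑ [1‥ N ] (λ t → length (layer t s)) + (d₁ + d₂ + d₃) ≤⟨ ∑-[1‥]-surplus 3≤N _ _ layer-bound₀ b₁ b₂ b₃ ⟩
        ∑[ t ∈ [1‥ N ] ] (2 * level t)                        ≡⟨ ∑-*ˡ [1‥ N ] 2 level ⟩
        2 * ∑ [1‥ N ] level                                   ≡⟨ cong (2 *_) (sym card-liftVertices) ⟩
        2 * card _≟L_ (liftVertices X)                        ∎
        where open ≤-Reasoning

      open TopLayer

      first-layer : (∀ v → fibre v ≤ 1) → length (layer 1 s) + 3 ≤ 2 * level 1
      first-layer fibres≤1 = layer-bound₃ 1 (top-layer-rank-zero 1 fibres≤1 p-prime q-prime p≢2 q≢2 (s≤s z≤n) ≤-refl)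
        (proj₂ (layer-1-nonempty s (proj₂ (length-pos⇒∈ X-nonempty))))

      second-layer : (∀ v → fibre v ≤ 2) → 1 ≤ level 2 → length (layer 2 s) + 2 ≤ 2 * level 2
      second-layer fibres≤2 1≤level
        with layer 2 s | layer-bound₃ 2 (top-layer-rank-zero 2 fibres≤2 p-prime q-prime p≢2 q≢2 ≤-refl (s≤s z≤n))
      ... | [] | _ = *-monoʳ-≤ 2 1≤level
      ... | es@(_ ∷ _) | bound = ≤-trans (+-monoʳ-≤ (length es) (n≤1+n 2)) (bound (here refl))

      with-bonus-0 : ∀ t → length (layer t s) + 0 ≤ 2 * level t
      with-bonus-0 t = subst (_≤ 2 * level t) (sym (+-identityʳ _)) (layer-bound₀ t)

    lift-laman-bound : length X + 3 ≤ 2 * card _≟L_ (liftVertices X)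
    lift-laman-bound with Fin.any? (λ v → 3 ≤? fibre v)
    ... | yes (v , 3≤) = bonus 1 1 1 refl
      (layer-bound₁ 1 (level-pos 1 (≤-trans (s≤s z≤n) 3≤)))
      (layer-bound₁ 2 (level-pos 2 (≤-trans (s≤s (s≤s z≤n)) 3≤)))
      (layer-bound₁ 3 (level-pos 3 3≤))
    ... | no none₃ with Fin.any? (λ v → 2 ≤? fibre v)
    ...   | yes (v , 2≤) = bonus 1 2 0 refl (layer-bound₁ 1 (level-pos 1 (≤-trans (s≤s z≤n) 2≤)))
      (second-layer (fibres≤ 2 none₃) (level-pos 2 2≤)) (with-bonus-0 3)
    ...   | no none₂ = bonus 3 0 0 refl (first-layer (fibres≤ 1 none₂)) (with-bonus-0 2) (with-bonus-0 3)

proposition18 : (p q : ℕ) .{{_ : NonZero p}} .{{_ : NonZero q}} →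
    Prime p → Prime q → p ≢ 2 → q ≢ 2 → p ≢ q →
    (n : ℕ) (E : List (CEdge n p q)) → length E + 1 ≡ 2 * n →
    ConeLaman p q E ⇔ LamanSparse _≟L_ (lift p q E)
proposition18 p q p-prime q-prime p≢2 q≢2 _ n E edges = mk⇔
  (λ (sparse , _) X X⊆ X-nonempty → ToLift.lift-laman-bound p q E sparse X⊆ p-prime q-prime p≢2 q≢2 X-nonempty)
  (λ lift-sparse → let sparse = FromLift.coneLamanSparse p q E lift-sparse in sparse , Tight.tight E sparse edges)
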